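{- Let $u\in S_n$ and $\beta=(i_1,\dots,i_k)$ be as in the context, and suppose $1\in J$ (the first letter $i_1=i$ gives a bridge). Let $\beta'=(i_2,\dots,i_k)$. Let $\widehat{B}=\widehat{B}^{u,\beta}=(\widehat b_{y,x})_{1\le y,x\le m+f}$, where vertex $m+1$ corresponds to the leftmost bridge. Let $L=(l_{yx})$ and $R=(r_{yx})$ be the $(m+f)\times(m+f)$ matrices with $l_{yy}=r_{yy}=1$, $l_{y,m+1}=\widehat b_{y,m+1}$ for $y\ne m+1$, $r_{m+1,x}=\widehat b_{m+1,x}$ for $x\ne m+1$, and all other entries $0$. Let $Z_1$ be the $(m+f)\times(m+f)$ matrix with $(Z_1)_{y,x}=\widehat b'_{y',x'}$ for $x,y\neq m+1$ (where $x',y'$ are the vertices of $Q_{u,\beta'}$ corresponding to $x,y$ and $\widehat{B}^{u,\beta'}=(\widehat b'_{y',x'})$), $(Z_1)_{m+1,m+1}=-1$, and all other entries of row and column $m+1$ equal to $0$. Then $L\,\widehat{B}^{u,\beta}\,R=Z_1$.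
   Context: Demazure sequence. For $v\in S_n$ put $v\lhd s_i=vs_i$ if $\ell(vs_i)<\ell(v)$ and $v$ otherwise. For $u\in S_n$ and a braid word $\beta=(i_1,\dots,i_k)\in[n-1]^k$ set $u_k=u$, $u_{j-1}=u_j\lhd s_{i_j}$; assume $u_0=\mathrm{id}$. Let $J=\{l: u_l=u_{l-1}\}$. When $1\in J$, $u$ is also a subword of $\beta'=(i_2,\dots,i_k)$, the corresponding set for $(u,\beta')$ is $\{l-1: l\in J, l\ge2\}$, and the bridges of $G_{u,\beta'}$ correspond to the bridges of $G_{u,\beta}$ other than the leftmost one; for a vertex $x\ne m+1$ of $Q_{u,\beta}$, $x'$ denotes the vertex of $Q_{u,\beta'}$ of the corresponding bridge. 3D plabic graph. Draw $n$ horizontal strands; gap $l$ is the strip between strands $l$ and $l+1$ (from the bottom). For $j=1,\dots,k$ left to right draw a bridge (vertical edge) in gap $i_j$ if $j\in J$, otherwise a positive crossing of the strands bounding gap $i_j$. Faces are regions; the $n-1$ regions touching the left border are boundary regions, the $l$-th in gap $l$. Soap films. Each bridge $d$ has a soap film $C_d$ (the relative cycle of Galashin–Lam–Sherman-Bennett–Speyer's 3D plabic graphs), covering each region $R$ with multiplicity $\mathrm{mult}_R(C_d)\in\{0,1\}$: it starts at $d$ covering the region of gap $i_d$ just left of $d$, propagates leftward clinging to its strands, follows strands through crossings, and at a bridge in gap $i$ continues unchanged if it passes over the upper or under the lower strand of that bridge, otherwise its part in gap $i$ is cut off. Bridges whose film ends before the left border are mutable, others frozen; $m,f$ are their numbers.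 Films are indexed $C_1,\dots,C_{m+f}$: mutable ones left to right, then frozen ones left to right (so the leftmost bridge, being frozen, gives $C_{m+1}$); vertex $j$ corresponds to $C_j$. Half-arrow matrix. At each bridge in gap $i$, with $P_L,P_R$ the regions of gap $i$ just left/right of it, $P_A$ the region of gap $i+1$ at its upper endpoint, $P_C$ the region of gap $i-1$ at its lower endpoint, place half arrows: two $P_L\to P_R$, one each $P_R\to P_A$, $P_A\to P_L$, $P_R\to P_C$, $P_C\to P_L$. $H=(h_{ij})$, $h_{ij}=\tfrac12\sum_{\text{half arrows }P\to P'}(\mathrm{mult}_P(C_i)\mathrm{mult}_{P'}(C_j)-\mathrm{mult}_P(C_j)\mathrm{mult}_{P'}(C_i))$. Boundary correction. $\partial(C_j)\in\{0,1\}^{n-1}$ records multiplicities of $C_j$ on the boundary regions. $(a,b)=a^TMb$ with $M_{ii}=-1$, $M_{i,i\pm1}=\tfrac12$, other entries $0$. $D_{ij}=(\partial(C_i),\partial(C_j))$, and $\widehat{B}^{u,\beta}=H+D$. The same construction for $(u,\beta')$ gives $\widehat{B}^{u,\beta'}$. -}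

module Defs where

open import Data.Bool using (Bool; true; false; if_then_else_; _∧_; _∨_; not)
open import Data.Nat as ℕ using (ℕ; zero; suc; _∸_; _≡ᵇ_; _<ᵇ_; _≤ᵇ_)
open import Data.List as List
  using (List; []; _∷_; _++_; map; filterᵇ; length; upTo; concatMap; take; drop; foldr; null)
open import Data.Bool.ListAction using (any)
open import Data.List.Properties using (≡-dec)
open import Data.List.Relation.Binary.Permutation.Propositional using (_↭_)
open import Data.Product using (_×_; _,_; proj₁; proj₂)
open import Data.Maybe using (Maybe; just; nothing; fromMaybe)
open import Data.Fin using (Fin; toℕ) renaming (zero to fzero; suc to fsuc)
open import Data.Integer as ℤ using (ℤ)
open import Data.Rational as ℚ using (ℚ; 0ℚ; 1ℚ; ½)
open import Relation.Nullary.Decidable using (⌊_⌋)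
open import Relation.Binary.PropositionalEquality using (_≡_)

ix : {A : Set} → A → List A → ℕ → A
ix d []       _       = d
ix d (x ∷ xs) zero    = x
ix d (x ∷ xs) (suc i) = ix d xs i

-- 1-based position of a value in a list (its "height")
posOf : ℕ → List ℕ → ℕ
posOf a []       = 0
posOf a (x ∷ xs) = if a ≡ᵇ x then 1 else suc (posOf a xs)

range : ℕ → ℕ → List ℕ
range a b = map (a ℕ.+_) (upTo (b ∸ a))

-- Permutations of S_n in one-line notation [v(1), ..., v(n)], values 1..n

idPerm : ℕ → List ℕ
idPerm n = map suc (upTo n)

IsPerm : ℕ → List ℕ → Set
IsPerm n u = u ↭ idPerm n

ℓ : List ℕ → ℕ
ℓ []       = 0
ℓ (x ∷ xs) = length (filterᵇ (λ y → y <ᵇ x) xs) ℕ.+ ℓ xs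

-- v ↦ v s_i (swap the entries in positions i and i+1), i ≥ 1
_·s_ : List ℕ → ℕ → List ℕ
(x ∷ y ∷ xs) ·s suc zero    = y ∷ x ∷ xs
(x ∷ xs)     ·s suc (suc i) = x ∷ (xs ·s suc i)
xs           ·s _           = xs

_◁_ : List ℕ → ℕ → List ℕ
v ◁ i = if ℓ (v ·s i) <ᵇ ℓ v then v ·s i else v

headD : List (List ℕ) → List ℕ
headD []      = []
headD (x ∷ _) = x

-- the Demazure sequence [u_0, u_1, ..., u_k] with u_k = u, u_{j-1} = u_j ◁ s_{i_j}
demSeq : List ℕ → List ℕ → List (List ℕ)
demSeq u []      = u ∷ []
demSeq u (i ∷ β) = (headD s ◁ i) ∷ s
  where s = demSeq u β

_==ᴾ_ : List ℕ → List ℕ → Bool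
v ==ᴾ w = ⌊ ≡-dec ℕ._≟_ v w ⌋

flags : List (List ℕ) → List Bool
flags (a ∷ b ∷ r) = (b ==ᴾ a) ∷ flags (b ∷ r)
flags _           = []

-- Jflags u β = [ l ∈ J | l = 1..k ]  (entry l-1 says whether u_l = u_{l-1})
Jflags : List ℕ → List ℕ → List Bool
Jflags u β = flags (demSeq u β)

u₀ : List ℕ → List ℕ → List ℕ
u₀ u β = headD (demSeq u β)

OneInJ : List ℕ → List ℕ → Set
OneInJ u β = ix false (Jflags u β) 0 ≡ true

-- Columns are j = 1..k; positions t = 0..k, position t lies between
-- column t and column t+1 (position 0 is the left border).
-- Strands are labelled by their height at the left border (u_0 = id).

Region : Set
Region = ℕ × ℕ        -- (gap g, number of columns in gap g to its left)

-- strip of a soap film: lower strand P, upper strand Q, and for strands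
-- between them whether the film passes over them (true) or under (false)
Strip : Set
Strip = ℕ × ℕ × List (ℕ × Bool)

lookupInfo : List (ℕ × Bool) → ℕ → Maybe Bool
lookupInfo []             s = nothing
lookupInfo ((a , b) ∷ xs) s = if a ≡ᵇ s then just b else lookupInfo xs s

isTrue : Maybe Bool → Bool
isTrue (just b) = b
isTrue nothing  = false

isFalse : Maybe Bool → Bool
isFalse (just b) = not b
isFalse nothing  = false

regEq : Region → Region → Bool
regEq (a , b) (c , d) = (a ≡ᵇ c) ∧ (b ≡ᵇ d)

sumℤ : List ℤ → ℤ
sumℤ = foldr ℤ._+_ (ℤ.+ 0)

sumℚ : List ℚ → ℚ
sumℚ = foldr ℚ._+_ 0ℚ

module Construction (n : ℕ) (β : List ℕ) (J : List Bool) where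

  k : ℕ
  k = length β

  letter : ℕ → ℕ          -- i_j, for 1-based column j
  letter j = ix 0 β (j ∸ 1)

  isBr : ℕ → Bool
  isBr j = ix false J (j ∸ 1)

  statesFrom : List ℕ → List ℕ → List Bool → List (List ℕ)
  statesFrom s (g ∷ gs) (b ∷ bs) = s ∷ statesFrom (if b then s else s ·s g) gs bs
  statesFrom s _        _        = s ∷ []

  -- st t = labels of the strands at heights 1..n at position t
  st : ℕ → List ℕ
  st t = ix [] (statesFrom (idPerm n) β J) t

  labelAt : List ℕ → ℕ → ℕ
  labelAt s h = ix 0 s (h ∸ 1)

  cnt : ℕ → ℕ → ℕ
  cnt t g = length (filterᵇ (λ h → h ≡ᵇ g) (take t β))

  reg : ℕ → ℕ → Region
  reg g t = g , cnt t g

  -- Convention for positive crossings: at the (unique) crossing of two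
  -- strands, the strand with the smaller label passes over.
  over : ℕ → ℕ → Bool
  over a b = a <ᵇ b

  -- crossing the crossing at column t (from position t to t-1)
  crossStep : ℕ → Strip → Strip
  crossStep t (P , Q , info) = P , Q , map newInfo inside
    where
      g = letter t
      R = st t
      Lf = st (t ∸ 1)
      x = labelAt R g
      y = labelAt R (suc g)
      hP = posOf P Lf
      hQ = posOf Q Lf
      inside = take (hQ ∸ hP ∸ 1) (drop hP Lf)
      partner : ℕ → ℕ
      partner s = if s ≡ᵇ x then y else x
      newInfo : ℕ → ℕ × Bool
      newInfo s = s , fromMaybe (over (partner s) s) (lookupInfo info s)

  -- crossing the bridge at column t (from position t to t-1)
  bridgeStep : ℕ → Strip → List Strip
  bridgeStep t (P , Q , info) =
    if (posOf P R ≤ᵇ g) ∧ (suc g ≤ᵇ posOf Q R) ∧ not ok then pieces else (P , Q , info) ∷ []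
    where
      g = letter t
      R = st t
      a = labelAt R g
      b = labelAt R (suc g)
      ok = isTrue (lookupInfo info b) ∨ isFalse (lookupInfo info a)
      pieces = (if P ≡ᵇ a then [] else
                 (P , a , filterᵇ (λ p → posOf (proj₁ p) R <ᵇ posOf a R) info) ∷ [])
            ++ (if b ≡ᵇ Q then [] else
                 (b , Q , filterᵇ (λ p → posOf b R <ᵇ posOf (proj₁ p) R) info) ∷ [])

  step : ℕ → List Strip → List Strip
  step t S = if isBr t then concatMap (bridgeStep t) S else map (crossStep t) S

  cover : ℕ → List Strip → List Region
  cover t S = concatMap (λ s → map (λ g → reg g t)
                (range (posOf (proj₁ s) (st t)) (posOf (proj₁ (proj₂ s)) (st t)))) S

  -- propagate leftward from position t to 0: covered regions, final strips
  run : ℕ → List Strip → List Region × List Strip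
  run zero    S = cover 0 S , S
  run (suc t) S = cover (suc t) S ++ proj₁ r , proj₂ r
    where r = run t (step (suc t) S)

  film : ℕ → List Region × List Strip
  film d = run (d ∸ 1) ((labelAt s g , labelAt s (suc g) , []) ∷ [])
    where
      s = st (d ∸ 1)
      g = letter d

  isMutable : ℕ → Bool      -- film ends before the left border
  isMutable d = null (proj₂ (film d))

  mult : ℕ → Region → ℤ
  mult d R = if any (regEq R) (proj₁ (film d)) then ℤ.+ 1 else ℤ.+ 0

  bridges : List ℕ
  bridges = filterᵇ isBr (map suc (upTo k))

  mutables : List ℕ
  mutables = filterᵇ isMutable bridges

  -- vertex j (0-based j = 0..m+f-1) ↦ column of its bridge
  order : List ℕ
  order = mutables ++ filterᵇ (λ d → not (isMutable d)) bridges

  N : ℕ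
  N = length order

  m : ℕ
  m = length mutables

  arrowsAt : ℕ → List (Region × Region)
  arrowsAt e = (PL , PR) ∷ (PL , PR) ∷
               ((if suc i ≤ᵇ n ∸ 1 then (PR , PA) ∷ (PA , PL) ∷ [] else [])
             ++ (if 2 ≤ᵇ i then (PR , PC) ∷ (PC , PL) ∷ [] else []))
    where
      i = letter e
      PL = reg i (e ∸ 1)
      PR = reg i e
      PA = reg (suc i) e
      PC = reg (i ∸ 1) e

  halfArrows : List (Region × Region)
  halfArrows = concatMap arrowsAt bridges

  Hcol : ℕ → ℕ → ℚ
  Hcol d d' = sumℤ (map (λ a → (mult d (proj₁ a) ℤ.* mult d' (proj₂ a))
                               ℤ.- (mult d' (proj₁ a) ℤ.* mult d (proj₂ a))) halfArrows)
              ℚ./ 2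

  -- the pairing matrix M on Z^{n-1} (indices 1..n-1)
  Mentry : ℕ → ℕ → ℚ
  Mentry p q = if p ≡ᵇ q then ℚ.- 1ℚ else
               (if (suc p ≡ᵇ q) ∨ (suc q ≡ᵇ p) then ½ else 0ℚ)

  -- ∂(C_d)_g = multiplicity of C_d on the boundary region of gap g
  ∂ : ℕ → ℕ → ℚ
  ∂ d g = mult d (g , 0) ℚ./ 1

  Dcol : ℕ → ℕ → ℚ
  Dcol d d' = sumℚ (concatMap (λ p → map (λ q → ∂ d p ℚ.* Mentry p q ℚ.* ∂ d' q)
                                         (range 1 n)) (range 1 n))

  Bcol : ℕ → ℕ → ℚ
  Bcol d d' = Hcol d d' ℚ.+ Dcol d d'

  col : Fin N → ℕ
  col y = List.lookup order y

  Bhat : Fin N → Fin N → ℚ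
  Bhat y x = Bcol (col y) (col x)

Mat : ℕ → Set
Mat N = Fin N → Fin N → ℚ

∑ : ∀ {N} → (Fin N → ℚ) → ℚ
∑ {zero}  f = 0ℚ
∑ {suc N} f = f fzero ℚ.+ ∑ (λ i → f (fsuc i))

_⊗_ : ∀ {N} → Mat N → Mat N → Mat N
(A ⊗ B) y x = ∑ (λ z → A y z ℚ.* B z x)

module C (n : ℕ) (u β : List ℕ) = Construction n β (Jflags u β)

Nv : ℕ → List ℕ → List ℕ → ℕ
Nv n u β = C.N n u β

-- B̂^{u,β} as an (m+f)×(m+f) matrix (vertices 0-based)
B̂ : (n : ℕ) (u β : List ℕ) → Mat (Nv n u β)
B̂ n u β = C.Bhat n u β

tail : List ℕ → List ℕ
tail []      = []
tail (_ ∷ xs) = xs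

module Lemma (n : ℕ) (u β : List ℕ) where
  open C n u β using (m; col)

  -- 0-based index of vertex m+1 is m
  isM : ∀ {N} → Fin N → Bool
  isM y = toℕ y ≡ᵇ m

  Lmat : Mat (Nv n u β)
  Lmat y x = if toℕ y ≡ᵇ toℕ x then 1ℚ else (if isM x then B̂ n u β y x else 0ℚ)

  Rmat : Mat (Nv n u β)
  Rmat y x = if toℕ y ≡ᵇ toℕ x then 1ℚ else (if isM y then B̂ n u β y x else 0ℚ)

  -- entries of B̂^{u,β'} indexed by bridges of β' (columns of β' = columns of β minus 1)
  Z₁ : Mat (Nv n u β)
  Z₁ y x = if isM y ∧ isM x then ℚ.- 1ℚ else
           (if isM y ∨ isM x then 0ℚ else
             C.Bcol n u (tail β) (col y ∸ 1) (col x ∸ 1))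

open Lemma public using (Lmat; Rmat; Z₁)

-- Prepending a bridge in gap i at the far left of the plabic graph of β′ shifts every column by
-- one: a region (g , c) of β′ becomes the region (g , c + [g = i]) of β, and the only new region
-- is PL = (i , 0), left of the new bridge.  The new bridge can only cut films, so each old film
-- keeps its shifted regions and may gain PL, while the film of the new bridge is exactly {PL}.
-- Hence the half arrows of β are the shifted half arrows of β′ plus the five pairs at the new
-- bridge, and the boundary vectors only change in coordinate i.  Let jump d be the jump of the
-- film of column d across the new bridge and rightRow d the i-th row of the boundary pairing on
-- the regions just right of it.  Indexing by columns, with 1 the new bridge (vertex m+1) and
-- d, d′ ≥ 2 the others, one finds
--   b̂₁₁ = −1,   b̂₁d = −jump d,   b̂d₁ = 2 rightRow d − jump d,
--   b̂dd′ = b̂′dd′ + 2 jump d′ rightRow d − jump d jump d′,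
-- so b̂dd′ + b̂d₁ b̂₁d′ = b̂′dd′.  Conjugating by L and R is Gaussian elimination at the pivot
-- b̂₁₁ = −1, which puts exactly these Schur complements in place of the other entries.

module Submission where

open import Defs
open import Data.Bool using (Bool; true; false; if_then_else_; _∧_; _∨_; not; T; T?)
open import Data.Bool.Properties using (∨-comm; ∧-identityʳ; T-≡)
open import Data.Bool.ListAction using (any)
open import Data.Empty using (⊥-elim)
open import Data.Fin as Fin using (Fin; toℕ) renaming (zero to fzero; suc to fsuc)
import Data.Fin.Properties as Fin
open import Data.Integer as ℤ using (ℤ)
import Data.Integer.Properties as ℤ
open import Data.List as List using (List; []; _∷_; _++_; map; concatMap; upTo; length)
import Data.List.Properties as List
open import Data.List.Membership.Propositional using (_∈_; _∉_; find; lose)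
open import Data.List.Membership.Propositional.Properties
  using (∈-map⁺; ∈-map⁻; ∈-upTo⁺; ∈-upTo⁻; ∈-++⁺ˡ; ∈-++⁺ʳ; ∈-++⁻; ∈-concatMap⁺; ∈-concatMap⁻; ∈-lookup)
open import Data.List.Relation.Unary.All as All using (All; []; _∷_)
import Data.List.Relation.Unary.All.Properties as All
open import Data.List.Relation.Unary.Any using (here; there)
open import Data.List.Relation.Unary.Unique.Propositional using (Unique; _∷_)
import Data.List.Relation.Unary.Unique.Propositional.Properties as Unique
open import Data.Nat as ℕ using (ℕ; zero; suc; _∸_; _≡ᵇ_; _≤ᵇ_; _<ᵇ_; _≤_; _<_; z≤n; s≤s; _≟_)
import Data.Nat.Properties as ℕ
open import Data.Product using (_×_; _,_; proj₁; proj₂; Σ; uncurry)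
open import Data.Rational as ℚ using (ℚ; 0ℚ; 1ℚ; ½; _+_; _*_; _-_; -_; fromℚᵘ)
import Data.Rational.Properties as ℚ
open import Data.Rational.Unnormalised as ℚᵘ using (mkℚᵘ; *≡*)
import Data.Rational.Unnormalised.Properties as ℚᵘ
open import Data.Rational.Solver using (module +-*-Solver)
open import Data.Sum using (_⊎_; inj₁; inj₂)
open import Function using (_∘_; Equivalence)
open import Relation.Binary using (DecidableEquality)
open import Relation.Binary.PropositionalEquality
open import Relation.Nullary using (contradiction)
open import Relation.Nullary.Decidable using (Dec; yes; no; does; map′; _×-dec_; dec-true; dec-false)

open +-*-Solver

private
  variable
    A B C D E : Set

cong₃ : (f : A → B → C → D) {a a' : A} {b b' : B} {c c' : C} →
        a ≡ a' → b ≡ b' → c ≡ c' → f a b c ≡ f a' b' c'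
cong₃ f refl refl refl = refl

cong₄ : (f : A → B → C → D → E) {a a' : A} {b b' : B} {c c' : C} {d d' : D} →
        a ≡ a' → b ≡ b' → c ≡ c' → d ≡ d' → f a b c d ≡ f a' b' c' d'
cong₄ f refl refl refl refl = refl

T⇒≡true : ∀ {b} → T b → b ≡ true
T⇒≡true = Equivalence.to T-≡

≡true⇒T : ∀ {b} → b ≡ true → T b
≡true⇒T = Equivalence.from T-≡

≡ᵇ-refl : ∀ x → (x ≡ᵇ x) ≡ true
≡ᵇ-refl x = dec-true (x ≟ x) refl

≡ᵇ-≢ : ∀ {x y} → x ≢ y → (x ≡ᵇ y) ≡ false
≡ᵇ-≢ {x} {y} = dec-false (x ≟ y)

≡ᵇ-sym : ∀ x y → (x ≡ᵇ y) ≡ (y ≡ᵇ x)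
≡ᵇ-sym x y with x ≟ y
... | yes refl = refl
... | no x≢y   = trans (≡ᵇ-≢ x≢y) (sym (≡ᵇ-≢ (x≢y ∘ sym)))

n≢1+n : ∀ {n} → n ≢ suc n
n≢1+n = ℕ.1+n≢n ∘ sym

2+n≢n : ∀ {n} → suc (suc n) ≢ n
2+n≢n {n} = ℕ.>⇒≢ (ℕ.m<n⇒m<1+n (ℕ.n<1+n n))

suc[n∸1]≡n : ∀ {n} → 1 ≤ n → suc (n ∸ 1) ≡ n
suc[n∸1]≡n (s≤s z≤n) = refl

1+n∸n≡1 : ∀ n → suc n ∸ n ≡ 1
1+n∸n≡1 zero    = refl
1+n∸n≡1 (suc n) = 1+n∸n≡1 n

∈-if-[] : ∀ {x y : A} b → x ∈ (if b then [] else y ∷ []) → x ≡ y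
∈-if-[] false (here x≡y) = x≡y

∉-single : ∀ {x y : A} → x ≢ y → x ∉ y ∷ []
∉-single x≢y (here x≡y) = x≢y x≡y

filterᵇ-map : (p : B → Bool) (f : A → B) (xs : List A) →
              List.filterᵇ p (map f xs) ≡ map f (List.filterᵇ (p ∘ f) xs)
filterᵇ-map p f []       = refl
filterᵇ-map p f (x ∷ xs) with p (f x)
... | true  = cong (f x ∷_) (filterᵇ-map p f xs)
... | false = filterᵇ-map p f xs

𝟙 : Bool → ℚ
𝟙 b = if b then 1ℚ else 0ℚ

sumℚ-++ : ∀ xs ys → sumℚ (xs ++ ys) ≡ sumℚ xs + sumℚ ys
sumℚ-++ []       ys = sym (ℚ.+-identityˡ _)
sumℚ-++ (x ∷ xs) ys = trans (cong (x +_) (sumℚ-++ xs ys)) (sym (ℚ.+-assoc x _ _))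

sumℚ-concatMap : (f : A → List ℚ) (xs : List A) → sumℚ (concatMap f xs) ≡ sumℚ (map (sumℚ ∘ f) xs)
sumℚ-concatMap f []       = refl
sumℚ-concatMap f (x ∷ xs) = trans (sumℚ-++ (f x) _) (cong (sumℚ (f x) +_) (sumℚ-concatMap f xs))

sumℚ-map-zero : {f : A → ℚ} → (∀ x → f x ≡ 0ℚ) → ∀ xs → sumℚ (map f xs) ≡ 0ℚ
sumℚ-map-zero f≡0 []       = refl
sumℚ-map-zero f≡0 (x ∷ xs) = cong₂ _+_ (f≡0 x) (sumℚ-map-zero f≡0 xs)

sumℚ-map-*ˡ : ∀ a (f : A → ℚ) xs → sumℚ (map (λ x → a * f x) xs) ≡ a * sumℚ (map f xs)
sumℚ-map-*ˡ a f []       = sym (ℚ.*-zeroʳ a)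
sumℚ-map-*ˡ a f (x ∷ xs) = trans (cong (a * f x +_) (sumℚ-map-*ˡ a f xs)) (sym (ℚ.*-distribˡ-+ a _ _))

sumℚ-map-+ : ∀ (f g : A → ℚ) xs → sumℚ (map (λ x → f x + g x) xs) ≡ sumℚ (map f xs) + sumℚ (map g xs)
sumℚ-map-+ f g []       = refl
sumℚ-map-+ f g (x ∷ xs) rewrite sumℚ-map-+ f g xs =
  solve 4 (λ a b c d → (a :+ b) :+ (c :+ d) := (a :+ c) :+ (b :+ d)) refl (f x) (g x) _ _

sumℚ-if : ∀ (f : A → ℚ) c xs → sumℚ (map f (if c then xs else [])) ≡ 𝟙 c * sumℚ (map f xs)
sumℚ-if f true  xs = sym (ℚ.*-identityˡ (sumℚ (map f xs)))
sumℚ-if f false xs = sym (ℚ.*-zeroˡ (sumℚ (map f xs)))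

δ : ℕ → ℕ → ℚ
δ j x = if x ≡ᵇ j then 1ℚ else 0ℚ

δ-self : ∀ j → δ j j ≡ 1ℚ
δ-self j rewrite ≡ᵇ-refl j = refl

δ-≢ : ∀ {j x} → x ≢ j → δ j x ≡ 0ℚ
δ-≢ x≢j rewrite ≡ᵇ-≢ x≢j = refl

count : ℕ → List ℕ → ℚ
count j xs = sumℚ (map (δ j) xs)

count-∉ : ∀ {j} xs → j ∉ xs → count j xs ≡ 0ℚ
count-∉ []       j∉xs = refl
count-∉ (x ∷ xs) j∉xs = cong₂ _+_ (δ-≢ (λ x≡j → j∉xs (here (sym x≡j)))) (count-∉ xs (j∉xs ∘ there))

count-unique : ∀ {j xs} → Unique xs → j ∈ xs → count j xs ≡ 1ℚ
count-unique {j} {_ ∷ xs} (j∉xs ∷ _) (here refl) =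
  trans (cong₂ _+_ (δ-self j) (count-∉ xs (All.All¬⇒¬Any j∉xs))) (ℚ.+-identityʳ 1ℚ)
count-unique {j} {x ∷ _} (x∉xs ∷ xs!) (there j∈xs) =
  trans (cong₂ _+_ (δ-≢ (All.lookup x∉xs j∈xs)) (count-unique xs! j∈xs)) (ℚ.+-identityˡ 1ℚ)

sumℚ-update : ∀ {f g : ℕ → ℚ} j → (∀ x → x ≢ j → f x ≡ g x) →
              ∀ xs → sumℚ (map f xs) ≡ sumℚ (map g xs) + (f j - g j) * count j xs
sumℚ-update {f} {g} j f≡g xs = begin
  sumℚ (map f xs)                                             ≡⟨ cong sumℚ (List.map-cong pointwise xs) ⟩
  sumℚ (map (λ x → g x + (f j - g j) * δ j x) xs)             ≡⟨ sumℚ-map-+ g _ xs ⟩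
  sumℚ (map g xs) + sumℚ (map (λ x → (f j - g j) * δ j x) xs) ≡⟨ cong (sumℚ (map g xs) +_) (sumℚ-map-*ˡ (f j - g j) (δ j) xs) ⟩
  sumℚ (map g xs) + (f j - g j) * count j xs                  ∎
  where
  open ≡-Reasoning
  pointwise : ∀ x → f x ≡ g x + (f j - g j) * δ j x
  pointwise x with x ≟ j
  ... | yes refl rewrite δ-self x = solve 2 (λ a b → a := b :+ (a :- b) :* con 1ℚ) refl (f x) (g x)
  ... | no x≢j   rewrite δ-≢ x≢j | f≡g x x≢j = solve 2 (λ a b → a := a :+ b :* con 0ℚ) refl (g x) (f j - g j)

∈-range⁻ : ∀ {g} a b → g ∈ range a b → a ≤ g × g < b
∈-range⁻ {g} a b g∈ with ∈-map⁻ (a ℕ.+_) g∈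
... | x , x∈ , refl = ℕ.m≤m+n a x , subst (a ℕ.+ x <_) (ℕ.m+[n∸m]≡n a≤b) (ℕ.+-monoʳ-< a x<b∸a)
  where
  x<b∸a : x < b ∸ a
  x<b∸a = ∈-upTo⁻ x∈
  a≤b : a ≤ b
  a≤b = ℕ.<⇒≤ (ℕ.m∸n≢0⇒n<m (λ b∸a≡0 → ℕ.n≮0 (subst (x <_) b∸a≡0 x<b∸a)))

∈-range⁺ : ∀ {g a b} → a ≤ g → g < b → g ∈ range a b
∈-range⁺ a≤g g<b = subst (_∈ _) (ℕ.m+[n∸m]≡n a≤g) (∈-map⁺ _ (∈-upTo⁺ (ℕ.∸-monoˡ-< g<b a≤g)))

range-⊆ : ∀ {a b a' b' g} → a ≤ a' → b' ≤ b → g ∈ range a' b' → g ∈ range a b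
range-⊆ {a' = a'} {b'} a≤a' b'≤b g∈ with ∈-range⁻ a' b' g∈
... | a'≤g , g<b' = ∈-range⁺ (ℕ.≤-trans a≤a' a'≤g) (ℕ.<-≤-trans g<b' b'≤b)

range-unique : ∀ a b → Unique (range a b)
range-unique a b = Unique.map⁺ (ℕ.+-cancelˡ-≡ a _ _) (Unique.upTo⁺ (b ∸ a))

range-single : ∀ a → range a (suc a) ≡ a ∷ []
range-single a = trans (cong (λ m → map (a ℕ.+_) (upTo m)) (1+n∸n≡1 a)) (cong (_∷ []) (ℕ.+-identityʳ a))

count-range : ∀ a b j → count j (range a b) ≡ 𝟙 ((a ≤ᵇ j) ∧ (j <ᵇ b))
count-range a b j with a ≤ᵇ j in a≤ᵇj | j <ᵇ b in j<ᵇb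
... | true  | true  = count-unique (range-unique a b)
                        (∈-range⁺ (ℕ.≤ᵇ⇒≤ a j (≡true⇒T a≤ᵇj)) (ℕ.<ᵇ⇒< j b (≡true⇒T j<ᵇb)))
... | true  | false = count-∉ (range a b) (λ j∈ → subst T j<ᵇb (ℕ.<⇒<ᵇ (proj₂ (∈-range⁻ a b j∈))))
... | false | _     = count-∉ (range a b) (λ j∈ → subst T a≤ᵇj (ℕ.≤⇒≤ᵇ (proj₁ (∈-range⁻ a b j∈))))

idPerm-suc : ∀ n → idPerm (suc n) ≡ 1 ∷ map suc (idPerm n)
idPerm-suc n = cong (λ xs → 1 ∷ map suc xs) (sym (List.map-applyUpTo (λ x → x) suc n))

length-idPerm : ∀ n → length (idPerm n) ≡ n
length-idPerm n = trans (List.length-map suc (upTo n)) (List.length-upTo n)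

ix-map : ∀ {d d'} (f : ℕ → ℕ) xs j → j < length xs → ix d (map f xs) j ≡ f (ix d' xs j)
ix-map f (x ∷ xs) zero    _        = refl
ix-map f (x ∷ xs) (suc j) (s≤s j<) = ix-map f xs j j<

ix-idPerm : ∀ {n j} → j < n → ix 0 (idPerm n) j ≡ suc j
ix-idPerm {suc n} {zero}  _         = refl
ix-idPerm {suc n} {suc j} (s≤s j<n) = begin
  ix 0 (idPerm (suc n)) (suc j) ≡⟨ cong (λ xs → ix 0 xs (suc j)) (idPerm-suc n) ⟩
  ix 0 (map suc (idPerm n)) j   ≡⟨ ix-map suc (idPerm n) j (subst (j <_) (sym (length-idPerm n)) j<n) ⟩
  suc (ix 0 (idPerm n) j)       ≡⟨ cong suc (ix-idPerm j<n) ⟩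
  suc (suc j)                   ∎
  where open ≡-Reasoning

posOf-map-suc : ∀ a xs → posOf (suc a) (map suc xs) ≡ posOf a xs
posOf-map-suc a []       = refl
posOf-map-suc a (x ∷ xs) = cong (if a ≡ᵇ x then 1 else_) (cong suc (posOf-map-suc a xs))

posOf-idPerm : ∀ {n j} → j < n → posOf (suc j) (idPerm n) ≡ suc j
posOf-idPerm {suc n} {zero}  _         = refl
posOf-idPerm {suc n} {suc j} (s≤s j<n) = begin
  posOf (suc (suc j)) (idPerm (suc n))           ≡⟨ cong (posOf (suc (suc j))) (idPerm-suc n) ⟩
  suc (posOf (suc (suc j)) (map suc (idPerm n))) ≡⟨ cong suc (posOf-map-suc (suc j) (idPerm n)) ⟩
  suc (posOf (suc j) (idPerm n))                 ≡⟨ cong suc (posOf-idPerm j<n) ⟩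
  suc (suc j)                                    ∎
  where open ≡-Reasoning

fromℚᵘ-homo-+ : ∀ p q → fromℚᵘ (p ℚᵘ.+ q) ≡ fromℚᵘ p + fromℚᵘ q
fromℚᵘ-homo-+ p q =
  trans (ℚ.fromℚᵘ-cong (ℚᵘ.≃-sym (ℚᵘ.≃-trans (ℚ.toℚᵘ-homo-+ (fromℚᵘ p) (fromℚᵘ q))
                                             (ℚᵘ.+-cong (ℚ.toℚᵘ-fromℚᵘ p) (ℚ.toℚᵘ-fromℚᵘ q)))))
        (ℚ.fromℚᵘ-toℚᵘ _)

fromℚᵘ-homo-* : ∀ p q → fromℚᵘ (p ℚᵘ.* q) ≡ fromℚᵘ p * fromℚᵘ q
fromℚᵘ-homo-* p q =
  trans (ℚ.fromℚᵘ-cong (ℚᵘ.≃-sym (ℚᵘ.≃-trans (ℚ.toℚᵘ-homo-* (fromℚᵘ p) (fromℚᵘ q))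
                                             (ℚᵘ.*-cong (ℚ.toℚᵘ-fromℚᵘ p) (ℚ.toℚᵘ-fromℚᵘ q)))))
        (ℚ.fromℚᵘ-toℚᵘ _)

fromℚᵘ-homo‿- : ∀ p → fromℚᵘ (ℚᵘ.- p) ≡ - fromℚᵘ p
fromℚᵘ-homo‿- p =
  trans (ℚ.fromℚᵘ-cong (ℚᵘ.≃-sym (ℚᵘ.≃-trans (ℚ.toℚᵘ-homo‿- (fromℚᵘ p)) (ℚᵘ.-‿cong (ℚ.toℚᵘ-fromℚᵘ p)))))
        (ℚ.fromℚᵘ-toℚᵘ _)

ι : ℤ → ℚ
ι z = z ℚ./ 1

ι-homo-+ : ∀ a b → ι (a ℤ.+ b) ≡ ι a + ι b
ι-homo-+ a b = trans (ℚ.fromℚᵘ-cong {mkℚᵘ (a ℤ.+ b) 0} {mkℚᵘ a 0 ℚᵘ.+ mkℚᵘ b 0} (*≡* cross))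
                     (fromℚᵘ-homo-+ (mkℚᵘ a 0) (mkℚᵘ b 0))
  where
  cross : (a ℤ.+ b) ℤ.* ℤ.+ 1 ≡ (a ℤ.* ℤ.+ 1 ℤ.+ b ℤ.* ℤ.+ 1) ℤ.* ℤ.+ 1
  cross = trans (ℤ.*-identityʳ (a ℤ.+ b))
                (sym (trans (ℤ.*-identityʳ _) (cong₂ ℤ._+_ (ℤ.*-identityʳ a) (ℤ.*-identityʳ b))))

ι-homo-* : ∀ a b → ι (a ℤ.* b) ≡ ι a * ι b
ι-homo-* a b = fromℚᵘ-homo-* (mkℚᵘ a 0) (mkℚᵘ b 0)

ι-homo‿- : ∀ a → ι (ℤ.- a) ≡ - ι a
ι-homo‿- a = trans (ℚ.fromℚᵘ-cong {mkℚᵘ (ℤ.- a) 0} {ℚᵘ.- mkℚᵘ a 0} (*≡* refl)) (fromℚᵘ-homo‿- (mkℚᵘ a 0))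

/2≡½*ι : ∀ z → z ℚ./ 2 ≡ ½ * ι z
/2≡½*ι z = trans (ℚ.fromℚᵘ-cong {mkℚᵘ z 1} {mkℚᵘ (ℤ.+ 1) 1 ℚᵘ.* mkℚᵘ z 0}
                                (*≡* (cong (ℤ._* ℤ.+ 2) (sym (ℤ.*-identityˡ z)))))
                 (fromℚᵘ-homo-* (mkℚᵘ (ℤ.+ 1) 1) (mkℚᵘ z 0))

ι-sumℤ : ∀ (f : A → ℤ) xs → ι (sumℤ (map f xs)) ≡ sumℚ (map (ι ∘ f) xs)
ι-sumℤ f []       = refl
ι-sumℤ f (x ∷ xs) = trans (ι-homo-+ (f x) _) (cong (ι (f x) +_) (ι-sumℤ f xs))

-- The boundary pairing

-- c₁ and c₂ say whether the gaps i + 1 and i − 1 exist; `arrowsAt` uses the same two flags.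
rowShape : Bool → Bool → ℚ → ℚ → ℚ → ℚ
rowShape c₁ c₂ x x₊ x₋ = - x + 𝟙 c₁ * (½ * x₊) + 𝟙 c₂ * (½ * x₋)

-- M and pairing unfold to Construction.Mentry and Construction.Dcol: the latter is pairing (∂ d) (∂ d′).
module Pairing (n : ℕ) where

  M : ℕ → ℕ → ℚ
  M p q = if p ≡ᵇ q then - 1ℚ else (if (suc p ≡ᵇ q) ∨ (suc q ≡ᵇ p) then ½ else 0ℚ)

  pairing : (ℕ → ℚ) → (ℕ → ℚ) → ℚ
  pairing F G = sumℚ (concatMap (λ p → map (λ q → F p * M p q * G q) (range 1 n)) (range 1 n))

  row : ℕ → (ℕ → ℚ) → ℚ
  row p G = sumℚ (map (λ q → M p q * G q) (range 1 n))

  localRow : ℕ → ℚ → ℚ → ℚ → ℚ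
  localRow i = rowShape (suc i ≤ᵇ n ∸ 1) (2 ≤ᵇ i)

  M-sym : ∀ p q → M p q ≡ M q p
  M-sym p q rewrite ≡ᵇ-sym p q | ∨-comm (suc p ≡ᵇ q) (suc q ≡ᵇ p) = refl

  pairing-rows : ∀ F G → pairing F G ≡ sumℚ (map (λ p → F p * row p G) (range 1 n))
  pairing-rows F G = trans (sumℚ-concatMap _ (range 1 n)) (cong sumℚ (List.map-cong rowᵖ (range 1 n)))
    where
    rowᵖ : ∀ p → sumℚ (map (λ q → F p * M p q * G q) (range 1 n)) ≡ F p * row p G
    rowᵖ p = trans (cong sumℚ (List.map-cong (λ q → ℚ.*-assoc (F p) (M p q) (G q)) (range 1 n)))
                   (sumℚ-map-*ˡ (F p) _ (range 1 n))

  pairing-zeroˡ : ∀ G → pairing (λ _ → 0ℚ) G ≡ 0ℚ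
  pairing-zeroˡ G = trans (pairing-rows (λ _ → 0ℚ) G) (sumℚ-map-zero (λ p → ℚ.*-zeroˡ (row p G)) (range 1 n))

  pairing-zeroʳ : ∀ F → pairing F (λ _ → 0ℚ) ≡ 0ℚ
  pairing-zeroʳ F = trans (pairing-rows F (λ _ → 0ℚ)) (sumℚ-map-zero row₀ (range 1 n))
    where
    row₀ : ∀ p → F p * row p (λ _ → 0ℚ) ≡ 0ℚ
    row₀ p = trans (cong (F p *_) (sumℚ-map-zero (λ q → ℚ.*-zeroʳ (M p q)) (range 1 n))) (ℚ.*-zeroʳ (F p))

  module _ {i : ℕ} (1≤i : 1 ≤ i) (i<n : i < n) where

    private
      count-i : count i (range 1 n) ≡ 1ℚ
      count-i = count-unique (range-unique 1 n) (∈-range⁺ 1≤i i<n)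

    pairing-updateˡ : ∀ {F F'} G → (∀ p → p ≢ i → F p ≡ F' p) →
                      pairing F G ≡ pairing F' G + (F i - F' i) * row i G
    pairing-updateˡ {F} {F'} G F≡F' = begin
      pairing F G
        ≡⟨ pairing-rows F G ⟩
      sumℚ (map (λ p → F p * row p G) (range 1 n))
        ≡⟨ sumℚ-update i (λ p p≢i → cong (_* row p G) (F≡F' p p≢i)) (range 1 n) ⟩
      sumℚ (map (λ p → F' p * row p G) (range 1 n)) + (F i * row i G - F' i * row i G) * count i (range 1 n)
        ≡⟨ cong₂ (λ s c → s + (F i * row i G - F' i * row i G) * c) (sym (pairing-rows F' G)) count-i ⟩
      pairing F' G + (F i * row i G - F' i * row i G) * 1ℚ
        ≡⟨ solve 4 (λ s a a' r → s :+ (a :* r :- a' :* r) :* con 1ℚ := s :+ (a :- a') :* r) refl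
                   (pairing F' G) (F i) (F' i) (row i G) ⟩
      pairing F' G + (F i - F' i) * row i G ∎
      where open ≡-Reasoning

    pairing-updateʳ : ∀ F {G G'} → (∀ q → q ≢ i → G q ≡ G' q) →
                      pairing F G ≡ pairing F G' + (G i - G' i) * row i F
    pairing-updateʳ F {G} {G'} G≡G' = begin
      pairing F G
        ≡⟨ pairing-rows F G ⟩
      sumℚ (map (λ p → F p * row p G) (range 1 n))
        ≡⟨ cong sumℚ (List.map-cong rowᵖ (range 1 n)) ⟩
      sumℚ (map (λ p → F p * row p G' + (G i - G' i) * (M i p * F p)) (range 1 n))
        ≡⟨ sumℚ-map-+ _ _ (range 1 n) ⟩
      sumℚ (map (λ p → F p * row p G') (range 1 n)) + sumℚ (map (λ p → (G i - G' i) * (M i p * F p)) (range 1 n))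
        ≡⟨ cong₂ _+_ (sym (pairing-rows F G')) (sumℚ-map-*ˡ (G i - G' i) _ (range 1 n)) ⟩
      pairing F G' + (G i - G' i) * row i F ∎
      where
      open ≡-Reasoning
      rowᵖ : ∀ p → F p * row p G ≡ F p * row p G' + (G i - G' i) * (M i p * F p)
      rowᵖ p = begin
        F p * row p G
          ≡⟨ cong (F p *_) (sumℚ-update i (λ q q≢i → cong (M p q *_) (G≡G' q q≢i)) (range 1 n)) ⟩
        F p * (row p G' + (M p i * G i - M p i * G' i) * count i (range 1 n))
          ≡⟨ cong₂ (λ m c → F p * (row p G' + (m * G i - m * G' i) * c)) (M-sym p i) count-i ⟩
        F p * (row p G' + (M i p * G i - M i p * G' i) * 1ℚ)
          ≡⟨ solve 5 (λ f r m g g' → f :* (r :+ (m :* g :- m :* g') :* con 1ℚ) := f :* r :+ (g :- g') :* (m :* f))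
                     refl (F p) (row p G') (M i p) (G i) (G' i) ⟩
        F p * row p G' + (G i - G' i) * (M i p * F p) ∎

    pairing-indicatorˡ : ∀ {F} G → F i ≡ 1ℚ → (∀ p → p ≢ i → F p ≡ 0ℚ) → pairing F G ≡ row i G
    pairing-indicatorˡ {F} G Fi≡1 F≡0 = begin
      pairing F G                                   ≡⟨ pairing-updateˡ G F≡0 ⟩
      pairing (λ _ → 0ℚ) G + (F i - 0ℚ) * row i G   ≡⟨ cong₂ (λ z f → z + (f - 0ℚ) * row i G) (pairing-zeroˡ G) Fi≡1 ⟩
      0ℚ + (1ℚ - 0ℚ) * row i G                      ≡⟨ solve 1 (λ r → con 0ℚ :+ (con 1ℚ :- con 0ℚ) :* r := r) refl (row i G) ⟩
      row i G                                       ∎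
      where open ≡-Reasoning

    pairing-indicatorʳ : ∀ F {G} → G i ≡ 1ℚ → (∀ q → q ≢ i → G q ≡ 0ℚ) → pairing F G ≡ row i F
    pairing-indicatorʳ F {G} Gi≡1 G≡0 = begin
      pairing F G                                   ≡⟨ pairing-updateʳ F G≡0 ⟩
      pairing F (λ _ → 0ℚ) + (G i - 0ℚ) * row i F   ≡⟨ cong₂ (λ z g → z + (g - 0ℚ) * row i F) (pairing-zeroʳ F) Gi≡1 ⟩
      0ℚ + (1ℚ - 0ℚ) * row i F                      ≡⟨ solve 1 (λ r → con 0ℚ :+ (con 1ℚ :- con 0ℚ) :* r := r) refl (row i F) ⟩
      row i F                                       ∎
      where open ≡-Reasoning

  M-diag : ∀ p → M p p ≡ - 1ℚ
  M-diag p rewrite ≡ᵇ-refl p = refl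

  M-succ : ∀ p → M p (suc p) ≡ ½
  M-succ p rewrite ≡ᵇ-≢ (n≢1+n {p}) | ≡ᵇ-refl p = refl

  M-pred : ∀ p → M (suc p) p ≡ ½
  M-pred p rewrite ≡ᵇ-≢ (ℕ.1+n≢n {p}) | ≡ᵇ-≢ {suc (suc p)} {p} 2+n≢n | ≡ᵇ-refl p = refl

  M-far : ∀ p q → p ≢ q → suc p ≢ q → suc q ≢ p → M p q ≡ 0ℚ
  M-far p q p≢q 1+p≢q 1+q≢p rewrite ≡ᵇ-≢ p≢q | ≡ᵇ-≢ 1+p≢q | ≡ᵇ-≢ 1+q≢p = refl

  row-term : ∀ {i} → 1 ≤ i → ∀ q (G : ℕ → ℚ) →
             M i q * G q ≡ - G i * δ i q + ½ * G (suc i) * δ (suc i) q + ½ * G (i ∸ 1) * δ (i ∸ 1) q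
  row-term {suc p} _ q G with q ≟ suc p | q ≟ suc (suc p) | q ≟ p
  ... | yes refl | _ | _
    rewrite M-diag (suc p) | δ-self (suc p) | δ-≢ {suc (suc p)} {suc p} n≢1+n | δ-≢ {p} {suc p} ℕ.1+n≢n =
    solve 3 (λ g g₊ g₋ → con (- 1ℚ) :* g := :- g :* con 1ℚ :+ con ½ :* g₊ :* con 0ℚ :+ con ½ :* g₋ :* con 0ℚ) refl
      (G (suc p)) (G (suc (suc p))) (G p)
  ... | no _ | yes refl | _
    rewrite M-succ (suc p) | δ-≢ {suc p} {suc (suc p)} ℕ.1+n≢n | δ-self (suc (suc p)) | δ-≢ {p} {suc (suc p)} 2+n≢n =
    solve 3 (λ g g₊ g₋ → con ½ :* g₊ := :- g :* con 0ℚ :+ con ½ :* g₊ :* con 1ℚ :+ con ½ :* g₋ :* con 0ℚ) refl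
      (G (suc p)) (G (suc (suc p))) (G p)
  ... | no _ | no _ | yes refl
    rewrite M-pred p | δ-≢ {suc p} {p} n≢1+n | δ-≢ {suc (suc p)} {p} (≢-sym 2+n≢n) | δ-self p =
    solve 3 (λ g g₊ g₋ → con ½ :* g₋ := :- g :* con 0ℚ :+ con ½ :* g₊ :* con 0ℚ :+ con ½ :* g₋ :* con 1ℚ) refl
      (G (suc p)) (G (suc (suc p))) (G p)
  ... | no q≢i | no q≢i₊ | no q≢i₋
    rewrite M-far (suc p) q (≢-sym q≢i) (≢-sym q≢i₊) (q≢i₋ ∘ ℕ.suc-injective) | δ-≢ q≢i | δ-≢ q≢i₊ | δ-≢ q≢i₋ =
    solve 4 (λ g g₊ g₋ x → con 0ℚ :* x := :- g :* con 0ℚ :+ con ½ :* g₊ :* con 0ℚ :+ con ½ :* g₋ :* con 0ℚ) refl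
      (G (suc p)) (G (suc (suc p))) (G p) (G q)

  private
    count-succ : ∀ {i} → i < n → count (suc i) (range 1 n) ≡ 𝟙 (suc i ≤ᵇ n ∸ 1)
    count-succ (s≤s _) = count-range 1 n _

    count-pred : ∀ {i} → 1 ≤ i → i < n → count (i ∸ 1) (range 1 n) ≡ 𝟙 (2 ≤ᵇ i)
    count-pred {suc p} _ i<n
      rewrite count-range 1 n p | T⇒≡true (ℕ.<⇒<ᵇ (ℕ.<-trans (ℕ.n<1+n p) i<n)) = cong 𝟙 (∧-identityʳ _)

  row-formula : ∀ {i} → 1 ≤ i → i < n → ∀ G → row i G ≡ localRow i (G i) (G (suc i)) (G (i ∸ 1))
  row-formula {i} 1≤i i<n G = begin
    row i G
      ≡⟨ cong sumℚ (List.map-cong (λ q → row-term 1≤i q G) (range 1 n)) ⟩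
    sumℚ (map (λ q → - G i * δ i q + ½ * G (suc i) * δ (suc i) q + ½ * G (i ∸ 1) * δ (i ∸ 1) q) (range 1 n))
      ≡⟨ sumℚ-map-+ _ _ (range 1 n) ⟩
    sumℚ (map (λ q → - G i * δ i q + ½ * G (suc i) * δ (suc i) q) (range 1 n))
      + sumℚ (map (λ q → ½ * G (i ∸ 1) * δ (i ∸ 1) q) (range 1 n))
      ≡⟨ cong₂ _+_ (sumℚ-map-+ _ _ (range 1 n)) (sumℚ-map-*ˡ (½ * G (i ∸ 1)) (δ (i ∸ 1)) (range 1 n)) ⟩
    sumℚ (map (λ q → - G i * δ i q) (range 1 n)) + sumℚ (map (λ q → ½ * G (suc i) * δ (suc i) q) (range 1 n))
      + ½ * G (i ∸ 1) * count (i ∸ 1) (range 1 n)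
      ≡⟨ cong₂ (λ a b → a + b + ½ * G (i ∸ 1) * count (i ∸ 1) (range 1 n))
               (sumℚ-map-*ˡ (- G i) (δ i) (range 1 n)) (sumℚ-map-*ˡ (½ * G (suc i)) (δ (suc i)) (range 1 n)) ⟩
    - G i * count i (range 1 n) + ½ * G (suc i) * count (suc i) (range 1 n) + ½ * G (i ∸ 1) * count (i ∸ 1) (range 1 n)
      ≡⟨ cong₂ (λ c₀ c₊ → - G i * c₀ + ½ * G (suc i) * c₊ + ½ * G (i ∸ 1) * count (i ∸ 1) (range 1 n))
               (count-unique (range-unique 1 n) (∈-range⁺ 1≤i i<n)) (count-succ i<n) ⟩
    - G i * 1ℚ + ½ * G (suc i) * 𝟙 (suc i ≤ᵇ n ∸ 1) + ½ * G (i ∸ 1) * count (i ∸ 1) (range 1 n)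
      ≡⟨ cong (λ c₋ → - G i * 1ℚ + ½ * G (suc i) * 𝟙 (suc i ≤ᵇ n ∸ 1) + ½ * G (i ∸ 1) * c₋) (count-pred 1≤i i<n) ⟩
    - G i * 1ℚ + ½ * G (suc i) * 𝟙 (suc i ≤ᵇ n ∸ 1) + ½ * G (i ∸ 1) * 𝟙 (2 ≤ᵇ i)
      ≡⟨ solve 5 (λ g g₊ g₋ c₊ c₋ → :- g :* con 1ℚ :+ con ½ :* g₊ :* c₊ :+ con ½ :* g₋ :* c₋
                                   := :- g :+ c₊ :* (con ½ :* g₊) :+ c₋ :* (con ½ :* g₋))
               refl (G i) (G (suc i)) (G (i ∸ 1)) (𝟙 (suc i ≤ᵇ n ∸ 1)) (𝟙 (2 ≤ᵇ i)) ⟩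
    localRow i (G i) (G (suc i)) (G (i ∸ 1)) ∎
    where open ≡-Reasoning

-- Films and half arrows

-- Unlike the product instance of ≡-dec, this one has does (r ≟ᴿ s) reducing to regEq r s.
_≟ᴿ_ : DecidableEquality Region
(a , b) ≟ᴿ (c , d) = map′ (uncurry (cong₂ _,_)) (λ eq → cong proj₁ eq , cong proj₂ eq) ((a ≟ c) ×-dec (b ≟ d))

open import Data.List.Membership.DecPropositional _≟ᴿ_ using (_∈?_)

any-regEq : ∀ r L → any (regEq r) L ≡ does (r ∈? L)
any-regEq r []      = refl
any-regEq r (x ∷ L) = cong (regEq r x ∨_) (any-regEq r L)

does-cong : (A → B) → (B → A) → (a? : Dec A) (b? : Dec B) → does a? ≡ does b?
does-cong f g (yes a) (yes b) = refl
does-cong f g (yes a) (no ¬b) = contradiction (f a) ¬b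
does-cong f g (no ¬a) (yes b) = contradiction (g b) ¬a
does-cong f g (no ¬a) (no ¬b) = refl

flux : (Region → ℚ) → (Region → ℚ) → Region × Region → ℚ
flux μ ν (P , Q) = μ P * ν Q - ν P * μ Q

st-start : ∀ n β J → Construction.st n β J 0 ≡ idPerm n
st-start n []      _       = refl
st-start n (_ ∷ _) []      = refl
st-start n (_ ∷ _) (_ ∷ _) = refl

module Films (n : ℕ) (β : List ℕ) (J : List Bool) where
  open Construction n β J

  stripCover : ℕ → Strip → List Region
  stripCover t s = map (λ g → reg g t) (range (posOf (proj₁ s) (st t)) (posOf (proj₁ (proj₂ s)) (st t)))

  regions : ℕ → List Region
  regions d = proj₁ (film d)

  mult-regions : ∀ d r → mult d r ≡ (if does (r ∈? regions d) then ℤ.+ 1 else ℤ.+ 0)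
  mult-regions d r = cong (if_then ℤ.+ 1 else ℤ.+ 0) (any-regEq r (regions d))

  finalCover⊆regions : ∀ t S {x} → x ∈ cover 0 (proj₂ (run t S)) → x ∈ proj₁ (run t S)
  finalCover⊆regions zero    S x∈ = x∈
  finalCover⊆regions (suc t) S x∈ = ∈-++⁺ʳ (cover (suc t) S) (finalCover⊆regions t (step (suc t) S) x∈)

  μ : ℕ → Region → ℚ
  μ d = ι ∘ mult d

  Hcol-flux : ∀ d d' → Hcol d d' ≡ ½ * sumℚ (map (flux (μ d) (μ d')) halfArrows)
  Hcol-flux d d' = trans (/2≡½*ι (sumℤ (map term halfArrows)))
                         (cong (½ *_) (trans (ι-sumℤ term halfArrows) (cong sumℚ (List.map-cong ι-term halfArrows))))
    where
    term : Region × Region → ℤ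
    term a = mult d (proj₁ a) ℤ.* mult d' (proj₂ a) ℤ.- mult d' (proj₁ a) ℤ.* mult d (proj₂ a)
    ι-term : ∀ a → ι (term a) ≡ flux (μ d) (μ d') a
    ι-term (P , Q) = trans (ι-homo-+ (mult d P ℤ.* mult d' Q) _)
                           (cong₂ _+_ (ι-homo-* (mult d P) (mult d' Q))
                                      (trans (ι-homo‿- (mult d' P ℤ.* mult d Q)) (cong -_ (ι-homo-* (mult d' P) (mult d Q)))))

arrowPattern : Region → Region → Region → Region → Bool → Bool → List (Region × Region)
arrowPattern PL PR PA PC c₁ c₂ =
  (PL , PR) ∷ (PL , PR) ∷ ((if c₁ then (PR , PA) ∷ (PA , PL) ∷ [] else []) ++ (if c₂ then (PR , PC) ∷ (PC , PL) ∷ [] else []))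

arrowPattern-flux : ∀ (μ ν : Region → ℚ) PL PR PA PC c₁ c₂ →
  ½ * sumℚ (map (flux μ ν) (arrowPattern PL PR PA PC c₁ c₂))
  ≡ (ν PL - ν PR) * rowShape c₁ c₂ (μ PR) (μ PA) (μ PC) - (μ PL - μ PR) * rowShape c₁ c₂ (ν PR) (ν PA) (ν PC)
arrowPattern-flux μ ν PL PR PA PC c₁ c₂ = begin
  ½ * (f (PL , PR) + (f (PL , PR) + sumℚ (map f (above ++ below))))
    ≡⟨ cong (λ s → ½ * (f (PL , PR) + (f (PL , PR) + s)))
            (trans (cong sumℚ (List.map-++ f above below)) (sumℚ-++ (map f above) (map f below))) ⟩
  ½ * (f (PL , PR) + (f (PL , PR) + (sumℚ (map f above) + sumℚ (map f below))))
    ≡⟨ cong₂ (λ a b → ½ * (f (PL , PR) + (f (PL , PR) + (a + b)))) (sumℚ-if f c₁ _) (sumℚ-if f c₂ _) ⟩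
  ½ * (f (PL , PR) + (f (PL , PR) + (𝟙 c₁ * (f (PR , PA) + (f (PA , PL) + 0ℚ)) + 𝟙 c₂ * (f (PR , PC) + (f (PC , PL) + 0ℚ)))))
    ≡⟨ solve 10 (λ μL μR μA μC νL νR νA νC k₁ k₂ →
           con ½ :* ((μL :* νR :- νL :* μR) :+ ((μL :* νR :- νL :* μR)
                     :+ (k₁ :* ((μR :* νA :- νR :* μA) :+ ((μA :* νL :- νA :* μL) :+ con 0ℚ))
                         :+ k₂ :* ((μR :* νC :- νR :* μC) :+ ((μC :* νL :- νC :* μL) :+ con 0ℚ)))))
           := (νL :- νR) :* (:- μR :+ k₁ :* (con ½ :* μA) :+ k₂ :* (con ½ :* μC))
              :- (μL :- μR) :* (:- νR :+ k₁ :* (con ½ :* νA) :+ k₂ :* (con ½ :* νC)))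
         refl (μ PL) (μ PR) (μ PA) (μ PC) (ν PL) (ν PR) (ν PA) (ν PC) (𝟙 c₁) (𝟙 c₂) ⟩
  (ν PL - ν PR) * rowShape c₁ c₂ (μ PR) (μ PA) (μ PC) - (μ PL - μ PR) * rowShape c₁ c₂ (ν PR) (ν PA) (ν PC) ∎
  where
  open ≡-Reasoning
  f : Region × Region → ℚ
  f = flux μ ν
  above below : List (Region × Region)
  above = if c₁ then (PR , PA) ∷ (PA , PL) ∷ [] else []
  below = if c₂ then (PR , PC) ∷ (PC , PL) ∷ [] else []

-- Prepending a bridge

module Prepend (n i : ℕ) (β' : List ℕ) (J' : List Bool) where
  module B  = Construction n (i ∷ β') (true ∷ J')
  module B' = Construction n β' J'
  module F  = Films n (i ∷ β') (true ∷ J')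
  module F' = Films n β' J'

  shift : Region → Region
  shift (g , c) = g , (if i ≡ᵇ g then suc c else c)

  reg-shift : ∀ g t → B.reg g (suc t) ≡ shift (B'.reg g t)
  reg-shift g t with i ≡ᵇ g
  ... | true  = refl
  ... | false = refl

  shift-injective : ∀ {r s} → shift r ≡ shift s → r ≡ s
  shift-injective {g , c} {g' , c'} eq with cong proj₁ eq
  ... | refl with i ≡ᵇ g
  ...   | true  = cong (g ,_) (ℕ.suc-injective (cong proj₂ eq))
  ...   | false = cong (g ,_) (cong proj₂ eq)

  shift≢start : ∀ r → shift r ≢ (i , 0)
  shift≢start (g , c) eq with cong proj₁ eq
  ... | refl rewrite ≡ᵇ-refl i with cong proj₂ eq
  ...   | ()

  cover-shift : ∀ t S → B.cover (suc t) S ≡ map shift (B'.cover t S)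
  cover-shift t S = sym (trans (List.map-concatMap shift _ S) (List.concatMap-cong shiftGaps S))
    where
    shiftGaps : ∀ s → map shift (map (λ g → B'.reg g t) _) ≡ map (λ g → B.reg g (suc t)) _
    shiftGaps s = trans (sym (List.map-∘ _)) (List.map-cong (λ g → sym (reg-shift g t)) _)

  regions-run : ∀ t S → proj₁ (B.run (suc t) S) ≡ map shift (proj₁ (B'.run t S)) ++ B.cover 0 (B.step 1 (proj₂ (B'.run t S)))
  regions-run zero    S = cong (_++ B.cover 0 (B.step 1 S)) (cover-shift 0 S)
  regions-run (suc t) S = begin
    B.cover (suc (suc t)) S ++ proj₁ (B.run (suc t) S′)
      ≡⟨ cong₂ _++_ (cover-shift (suc t) S) (regions-run t S′) ⟩
    map shift (B'.cover (suc t) S) ++ (map shift (proj₁ (B'.run t S′)) ++ rest)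
      ≡⟨ sym (List.++-assoc (map shift (B'.cover (suc t) S)) _ rest) ⟩
    (map shift (B'.cover (suc t) S) ++ map shift (proj₁ (B'.run t S′))) ++ rest
      ≡⟨ cong (_++ rest) (sym (List.map-++ shift (B'.cover (suc t) S) _)) ⟩
    map shift (B'.cover (suc t) S ++ proj₁ (B'.run t S′)) ++ rest ∎
    where
    open ≡-Reasoning
    S′ : List Strip
    S′ = B'.step (suc t) S
    rest : List Region
    rest = B.cover 0 (B.step 1 (proj₂ (B'.run t S′)))

  module _ (1≤i : 1 ≤ i) (i<n : i < n) where

    private
      st₁ : B.st 1 ≡ idPerm n
      st₁ = st-start n β' J'

      i∸1<n : i ∸ 1 < n
      i∸1<n = ℕ.≤-<-trans (ℕ.m∸n≤m i 1) i<n

      id-pos-low : posOf (ix 0 (idPerm n) (i ∸ 1)) (idPerm n) ≡ i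
      id-pos-low = begin
        posOf (ix 0 (idPerm n) (i ∸ 1)) (idPerm n) ≡⟨ cong (λ a → posOf a (idPerm n)) (ix-idPerm i∸1<n) ⟩
        posOf (suc (i ∸ 1)) (idPerm n)             ≡⟨ posOf-idPerm i∸1<n ⟩
        suc (i ∸ 1)                                ≡⟨ suc[n∸1]≡n 1≤i ⟩
        i                                          ∎
        where open ≡-Reasoning

      id-pos-high : posOf (ix 0 (idPerm n) i) (idPerm n) ≡ suc i
      id-pos-high = trans (cong (λ a → posOf a (idPerm n)) (ix-idPerm i<n)) (posOf-idPerm i<n)

    pos-label-low : posOf (B.labelAt (B.st 1) i) (B.st 1) ≡ i
    pos-label-low = subst (λ R → posOf (ix 0 R (i ∸ 1)) R ≡ i) (sym st₁) id-pos-low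

    pos-label-high : posOf (B.labelAt (B.st 1) (suc i)) (B.st 1) ≡ suc i
    pos-label-high = subst (λ R → posOf (ix 0 R i) R ≡ suc i) (sym st₁) id-pos-high

    lower upper : Strip → ℕ
    lower s = posOf (proj₁ s) (B.st 1)
    upper s = posOf (proj₁ (proj₂ s)) (B.st 1)

    private
      unchanged : ∀ {s s'} → s' ∈ s ∷ [] → lower s ≤ lower s' × upper s' ≤ upper s
      unchanged (here refl) = ℕ.≤-refl , ℕ.≤-refl

    bridgeStep-narrows : ∀ s {s'} → s' ∈ B.bridgeStep 1 s → lower s ≤ lower s' × upper s' ≤ upper s
    bridgeStep-narrows (P , Q , info) {s'} s'∈
      with posOf P (B.st 1) ≤ᵇ i in P≤ᵇi | suc i ≤ᵇ posOf Q (B.st 1) in i<ᵇQ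
    ... | false | _     = unchanged s'∈
    ... | true  | false = unchanged s'∈
    ... | true  | true
      with isTrue (lookupInfo info (B.labelAt (B.st 1) (suc i))) ∨ isFalse (lookupInfo info (B.labelAt (B.st 1) i))
    ...   | true  = unchanged s'∈
    ...   | false with ∈-++⁻ (if P ≡ᵇ B.labelAt (B.st 1) i then [] else _ ∷ []) s'∈
    ...     | inj₁ s'∈ₗ rewrite ∈-if-[] (P ≡ᵇ B.labelAt (B.st 1) i) s'∈ₗ =
            ℕ.≤-refl , subst (_≤ posOf Q (B.st 1)) (sym pos-label-low)
                             (ℕ.<⇒≤ (ℕ.≤ᵇ⇒≤ (suc i) _ (≡true⇒T i<ᵇQ)))
    ...     | inj₂ s'∈ᵤ rewrite ∈-if-[] (B.labelAt (B.st 1) (suc i) ≡ᵇ Q) s'∈ᵤ =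
            subst (posOf P (B.st 1) ≤_) (sym pos-label-high)
                  (ℕ.m≤n⇒m≤1+n (ℕ.≤ᵇ⇒≤ _ i (≡true⇒T P≤ᵇi))) , ℕ.≤-refl

    reg-first-column : ∀ {g} → g ≢ i → B.reg g 1 ≡ (g , 0)
    reg-first-column {g} g≢i = trans (reg-shift g 0) (cong (λ b → g , (if b then 1 else 0)) (≡ᵇ-≢ (g≢i ∘ sym)))

    cover-bridge : ∀ S {x} → x ∈ B.cover 0 (B.step 1 S) → x ≡ (i , 0) ⊎ x ∈ B.cover 1 S
    cover-bridge S x∈ with find (∈-concatMap⁻ (F.stripCover 0) {xs = B.step 1 S} x∈)
    ... | s' , s'∈ , x∈s' with find (∈-concatMap⁻ (B.bridgeStep 1) {xs = S} s'∈) | ∈-map⁻ (λ g → B.reg g 0) x∈s'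
    ... | s , s∈S , s'∈s | g , g∈ , refl with g ≟ i
    ...   | yes refl = inj₁ refl
    ...   | no g≢i   = inj₂ (∈-concatMap⁺ (F.stripCover 1) {xs = S}
                             (lose s∈S (subst (_∈ F.stripCover 1 s) (reg-first-column g≢i) (∈-map⁺ (λ g → B.reg g 1) g∈gaps))))
      where
      narrow : lower s ≤ lower s' × upper s' ≤ upper s
      narrow = bridgeStep-narrows s s'∈s
      g∈gaps : g ∈ range (lower s) (upper s)
      g∈gaps = range-⊆ (proj₁ narrow) (proj₂ narrow)
                       (subst (λ R → g ∈ range (posOf (proj₁ s') R) (posOf (proj₁ (proj₂ s')) R)) (sym st₁) g∈)

    regions-first : F.regions 1 ≡ (i , 0) ∷ []
    regions-first = begin
      map (λ g → B.reg g 0) (range (posOf (ix 0 (idPerm n) (i ∸ 1)) (idPerm n)) (posOf (ix 0 (idPerm n) i) (idPerm n))) ++ []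
        ≡⟨ cong₂ (λ a b → map (λ g → B.reg g 0) (range a b) ++ []) id-pos-low id-pos-high ⟩
      map (λ g → B.reg g 0) (range i (suc i)) ++ []
        ≡⟨ cong (λ gs → map (λ g → B.reg g 0) gs ++ []) (range-single i) ⟩
      (i , 0) ∷ [] ∎
      where open ≡-Reasoning

    module _ (e : ℕ) where
      private
        -- the starting strip of the film of column suc e of β′, and of column suc (suc e) of β
        S₀ : List Strip
        S₀ = (B'.labelAt (B'.st e) (B'.letter (suc e)) , B'.labelAt (B'.st e) (suc (B'.letter (suc e))) , []) ∷ []
        Sₑ : List Strip
        Sₑ = proj₂ (B'.run e S₀)

      shift∈regions⁻ : ∀ {r} → shift r ∈ F.regions (suc (suc e)) → r ∈ F'.regions (suc e)
      shift∈regions⁻ {r} r∈ with ∈-++⁻ (map shift (F'.regions (suc e))) (subst (shift r ∈_) (regions-run e S₀) r∈)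
      ... | inj₁ r∈shifted with ∈-map⁻ shift r∈shifted
      ...   | s , s∈ , eq = subst (_∈ _) (sym (shift-injective eq)) s∈
      shift∈regions⁻ {r} r∈ | inj₂ r∈final with cover-bridge Sₑ r∈final
      ...   | inj₁ eq      = ⊥-elim (shift≢start r eq)
      ...   | inj₂ r∈cover with ∈-map⁻ shift (subst (shift r ∈_) (cover-shift 0 Sₑ) r∈cover)
      ...     | s , s∈ , eq = F'.finalCover⊆regions e S₀ (subst (_∈ _) (sym (shift-injective eq)) s∈)

      shift∈regions⁺ : ∀ {r} → r ∈ F'.regions (suc e) → shift r ∈ F.regions (suc (suc e))
      shift∈regions⁺ r∈ = subst (_ ∈_) (sym (regions-run e S₀)) (∈-++⁺ˡ (∈-map⁺ shift r∈))

      mult-shift : ∀ r → B.mult (suc (suc e)) (shift r) ≡ B'.mult (suc e) r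
      mult-shift r = begin
        B.mult (suc (suc e)) (shift r)
          ≡⟨ F.mult-regions (suc (suc e)) (shift r) ⟩
        (if does (shift r ∈? F.regions (suc (suc e))) then ℤ.+ 1 else ℤ.+ 0)
          ≡⟨ cong (if_then ℤ.+ 1 else ℤ.+ 0) (does-cong shift∈regions⁻ shift∈regions⁺ (shift r ∈? _) (r ∈? _)) ⟩
        (if does (r ∈? F'.regions (suc e)) then ℤ.+ 1 else ℤ.+ 0)
          ≡⟨ sym (F'.mult-regions (suc e) r) ⟩
        B'.mult (suc e) r ∎
        where open ≡-Reasoning

  shift² : Region × Region → Region × Region
  shift² (P , Q) = shift P , shift Q

  arrowsAt-shift : ∀ e → B.arrowsAt (suc (suc e)) ≡ map shift² (B'.arrowsAt (suc e))
  arrowsAt-shift e = trans (cong₄ (λ PL PR PA PC → arrowPattern PL PR PA PC c₁ c₂)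
                                  (reg-shift l e) (reg-shift l (suc e)) (reg-shift (suc l) (suc e)) (reg-shift (l ∸ 1) (suc e)))
                           (sym (map-arrowPattern c₁ c₂))
    where
    l : ℕ
    l = B'.letter (suc e)
    c₁ c₂ : Bool
    c₁ = suc l ≤ᵇ n ∸ 1
    c₂ = 2 ≤ᵇ l
    map-arrowPattern : ∀ {PL PR PA PC} c₁ c₂ → map shift² (arrowPattern PL PR PA PC c₁ c₂)
                       ≡ arrowPattern (shift PL) (shift PR) (shift PA) (shift PC) c₁ c₂
    map-arrowPattern true  true  = refl
    map-arrowPattern true  false = refl
    map-arrowPattern false true  = refl
    map-arrowPattern false false = refl

  innerBridges : List ℕ
  innerBridges = List.filterᵇ (B'.isBr ∘ suc) (upTo (List.length β'))

  bridges-inner : B'.bridges ≡ map suc innerBridges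
  bridges-inner = filterᵇ-map B'.isBr suc (upTo (List.length β'))

  bridges-prepend : B.bridges ≡ 1 ∷ map suc (map suc innerBridges)
  bridges-prepend = cong (1 ∷_) (begin
    List.filterᵇ B.isBr (map suc (List.applyUpTo suc (List.length β')))
      ≡⟨ cong (List.filterᵇ B.isBr ∘ map suc) (sym (List.map-applyUpTo (λ x → x) suc (List.length β'))) ⟩
    List.filterᵇ B.isBr (map suc (map suc (upTo (List.length β'))))
      ≡⟨ filterᵇ-map B.isBr suc (map suc (upTo (List.length β'))) ⟩
    map suc (List.filterᵇ (B.isBr ∘ suc) (map suc (upTo (List.length β'))))
      ≡⟨ cong (map suc) (filterᵇ-map (B.isBr ∘ suc) suc (upTo (List.length β'))) ⟩
    map suc (map suc innerBridges) ∎)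
    where open ≡-Reasoning

  halfArrows-prepend : B.halfArrows ≡ B.arrowsAt 1 ++ map shift² B'.halfArrows
  halfArrows-prepend = begin
    concatMap B.arrowsAt B.bridges
      ≡⟨ cong (concatMap B.arrowsAt) bridges-prepend ⟩
    B.arrowsAt 1 ++ concatMap B.arrowsAt (map suc (map suc innerBridges))
      ≡⟨ cong (B.arrowsAt 1 ++_) (begin
           concatMap B.arrowsAt (map suc (map suc innerBridges))
             ≡⟨ trans (List.concatMap-map B.arrowsAt suc (map suc innerBridges))
                      (List.concatMap-map (B.arrowsAt ∘ suc) suc innerBridges) ⟩
           concatMap (B.arrowsAt ∘ suc ∘ suc) innerBridges
             ≡⟨ List.concatMap-cong arrowsAt-shift innerBridges ⟩
           concatMap (map shift² ∘ B'.arrowsAt ∘ suc) innerBridges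
             ≡⟨ sym (List.map-concatMap shift² (B'.arrowsAt ∘ suc) innerBridges) ⟩
           map shift² (concatMap (B'.arrowsAt ∘ suc) innerBridges)
             ≡⟨ cong (map shift²) (sym (trans (cong (concatMap B'.arrowsAt) bridges-inner)
                                               (List.concatMap-map B'.arrowsAt suc innerBridges))) ⟩
           map shift² B'.halfArrows ∎) ⟩
    B.arrowsAt 1 ++ map shift² B'.halfArrows ∎
    where open ≡-Reasoning

-- Entries of B̂ after prepending

module Entries (n i : ℕ) (β' : List ℕ) (J' : List Bool) (1≤i : 1 ≤ i) (i<n : i < n) where
  open Prepend n i β' J'
  open Pairing n
  open F using (μ)

  PL PR PA PC : Region
  PL = i , 0
  PR = B.reg i 1
  PA = B.reg (suc i) 1
  PC = B.reg (i ∸ 1) 1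

  jump : ℕ → ℚ
  jump d = μ d PL - μ d PR

  rightRow : ℕ → ℚ
  rightRow d = localRow i (μ d PR) (μ d PA) (μ d PC)

  mult-first : ∀ r → B.mult 1 r ≡ (if does (r ∈? PL ∷ []) then ℤ.+ 1 else ℤ.+ 0)
  mult-first r = trans (F.mult-regions 1 r) (cong (λ L → if does (r ∈? L) then ℤ.+ 1 else ℤ.+ 0) (regions-first 1≤i i<n))

  μ-first-PL : μ 1 PL ≡ 1ℚ
  μ-first-PL = cong ι (trans (mult-first PL) (cong (if_then ℤ.+ 1 else ℤ.+ 0) (dec-true (PL ∈? PL ∷ []) (here refl))))

  μ-first-≢ : ∀ {r} → r ≢ PL → μ 1 r ≡ 0ℚ
  μ-first-≢ {r} r≢PL =
    cong ι (trans (mult-first r) (cong (if_then ℤ.+ 1 else ℤ.+ 0) (dec-false (r ∈? PL ∷ []) (∉-single r≢PL))))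

  μ-first-shift : ∀ r → μ 1 (shift r) ≡ 0ℚ
  μ-first-shift r = μ-first-≢ (shift≢start r)

  μ-first-reg : ∀ g → μ 1 (B.reg g 1) ≡ 0ℚ
  μ-first-reg g = trans (cong (μ 1) (reg-shift g 0)) (μ-first-shift (B'.reg g 0))

  μ-shift : ∀ e r → μ (suc (suc e)) (shift r) ≡ F'.μ (suc e) r
  μ-shift e r = cong ι (mult-shift 1≤i i<n e r)

  μ-reg : ∀ e g → μ (suc (suc e)) (B.reg g 1) ≡ B'.∂ (suc e) g
  μ-reg e g = trans (cong (μ (suc (suc e))) (reg-shift g 0)) (μ-shift e (B'.reg g 0))

  jump-inner : ∀ e → jump (suc (suc e)) ≡ B.∂ (suc (suc e)) i - B'.∂ (suc e) i
  jump-inner e = cong (_-_ (μ (suc (suc e)) PL)) (μ-reg e i)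

  rightRow-inner : ∀ e → rightRow (suc (suc e)) ≡ row i (B'.∂ (suc e))
  rightRow-inner e = trans (cong₃ (localRow i) (μ-reg e i) (μ-reg e (suc i)) (μ-reg e (i ∸ 1)))
                           (sym (row-formula 1≤i i<n (B'.∂ (suc e))))

  jump-first : jump 1 ≡ 1ℚ
  jump-first = cong₂ _-_ μ-first-PL (μ-first-reg i)

  rightRow-first : rightRow 1 ≡ 0ℚ
  rightRow-first = trans (cong₃ (localRow i) (μ-first-reg i) (μ-first-reg (suc i)) (μ-first-reg (i ∸ 1)))
                         (solve 2 (λ k₁ k₂ → :- con 0ℚ :+ k₁ :* (con ½ :* con 0ℚ) :+ k₂ :* (con ½ :* con 0ℚ) := con 0ℚ)
                                refl (𝟙 (suc i ≤ᵇ n ∸ 1)) (𝟙 (2 ≤ᵇ i)))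

  shiftedFlux : ℕ → ℕ → ℚ
  shiftedFlux d d' = sumℚ (map (flux (μ d) (μ d')) (map shift² B'.halfArrows))

  Hcol-prepend : ∀ d d' → B.Hcol d d' ≡ (jump d' * rightRow d - jump d * rightRow d') + ½ * shiftedFlux d d'
  Hcol-prepend d d' = begin
    B.Hcol d d'
      ≡⟨ F.Hcol-flux d d' ⟩
    ½ * sumℚ (map f B.halfArrows)
      ≡⟨ cong (λ hs → ½ * sumℚ (map f hs)) halfArrows-prepend ⟩
    ½ * sumℚ (map f (B.arrowsAt 1 ++ map shift² B'.halfArrows))
      ≡⟨ cong (½ *_) (trans (cong sumℚ (List.map-++ f (B.arrowsAt 1) _)) (sumℚ-++ (map f (B.arrowsAt 1)) _)) ⟩
    ½ * (sumℚ (map f (B.arrowsAt 1)) + shiftedFlux d d')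
      ≡⟨ ℚ.*-distribˡ-+ ½ (sumℚ (map f (B.arrowsAt 1))) (shiftedFlux d d') ⟩
    ½ * sumℚ (map f (B.arrowsAt 1)) + ½ * shiftedFlux d d'
      ≡⟨ cong (_+ ½ * shiftedFlux d d') (arrowPattern-flux (μ d) (μ d') PL PR PA PC (suc i ≤ᵇ n ∸ 1) (2 ≤ᵇ i)) ⟩
    (jump d' * rightRow d - jump d * rightRow d') + ½ * shiftedFlux d d' ∎
    where
    open ≡-Reasoning
    f = flux (μ d) (μ d')

  shiftedFlux-inner : ∀ e e' → ½ * shiftedFlux (suc (suc e)) (suc (suc e')) ≡ B'.Hcol (suc e) (suc e')
  shiftedFlux-inner e e' = sym (trans (F'.Hcol-flux (suc e) (suc e'))
    (cong (½ *_) (trans (cong sumℚ (List.map-cong flux-shift B'.halfArrows)) (cong sumℚ (List.map-∘ B'.halfArrows)))))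
    where
    flux-shift : ∀ a → flux (F'.μ (suc e)) (F'.μ (suc e')) a ≡ flux (μ (suc (suc e))) (μ (suc (suc e'))) (shift² a)
    flux-shift (P , Q) = sym (cong₂ _-_ (cong₂ _*_ (μ-shift e P) (μ-shift e' Q)) (cong₂ _*_ (μ-shift e' P) (μ-shift e Q)))

  shiftedFlux-firstˡ : ∀ d → shiftedFlux 1 d ≡ 0ℚ
  shiftedFlux-firstˡ d = trans (cong sumℚ (sym (List.map-∘ B'.halfArrows))) (sumℚ-map-zero vanish B'.halfArrows)
    where
    vanish : ∀ a → flux (μ 1) (μ d) (shift² a) ≡ 0ℚ
    vanish (P , Q) rewrite μ-first-shift P | μ-first-shift Q =
      solve 2 (λ x y → con 0ℚ :* x :- y :* con 0ℚ := con 0ℚ) refl (μ d (shift Q)) (μ d (shift P))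

  shiftedFlux-firstʳ : ∀ d → shiftedFlux d 1 ≡ 0ℚ
  shiftedFlux-firstʳ d = trans (cong sumℚ (sym (List.map-∘ B'.halfArrows))) (sumℚ-map-zero vanish B'.halfArrows)
    where
    vanish : ∀ a → flux (μ d) (μ 1) (shift² a) ≡ 0ℚ
    vanish (P , Q) rewrite μ-first-shift P | μ-first-shift Q =
      solve 2 (λ x y → x :* con 0ℚ :- con 0ℚ :* y := con 0ℚ) refl (μ d (shift P)) (μ d (shift Q))

  ∂-first-≢ : ∀ p → p ≢ i → B.∂ 1 p ≡ 0ℚ
  ∂-first-≢ p p≢i = μ-first-≢ {p , 0} (p≢i ∘ cong proj₁)

  ∂-inner-≢ : ∀ e p → p ≢ i → B.∂ (suc (suc e)) p ≡ B'.∂ (suc e) p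
  ∂-inner-≢ e p p≢i = trans (cong (μ (suc (suc e))) (sym (reg-first-column 1≤i i<n p≢i))) (μ-reg e p)

  row-boundary : ∀ d → row i (B.∂ d) ≡ rightRow d - jump d
  row-boundary d = begin
    row i (B.∂ d)
      ≡⟨ row-formula 1≤i i<n (B.∂ d) ⟩
    localRow i (μ d PL) (μ d (suc i , 0)) (μ d (i ∸ 1 , 0))
      ≡⟨ cong₂ (localRow i (μ d PL)) (cong (μ d) (sym (reg-first-column 1≤i i<n ℕ.1+n≢n)))
                                     (cong (μ d) (sym (reg-first-column 1≤i i<n i∸1≢i))) ⟩
    localRow i (μ d PL) (μ d PA) (μ d PC)
      ≡⟨ solve 6 (λ a r p m k₁ k₂ → :- a :+ k₁ :* (con ½ :* p) :+ k₂ :* (con ½ :* m)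
                                 := (:- r :+ k₁ :* (con ½ :* p) :+ k₂ :* (con ½ :* m)) :- (a :- r))
               refl (μ d PL) (μ d PR) (μ d PA) (μ d PC) (𝟙 (suc i ≤ᵇ n ∸ 1)) (𝟙 (2 ≤ᵇ i)) ⟩
    rightRow d - jump d ∎
    where
    open ≡-Reasoning
    i∸1≢i : i ∸ 1 ≢ i
    i∸1≢i eq = n≢1+n (trans (sym (suc[n∸1]≡n 1≤i)) (cong suc eq))

  Dcol-first-row : ∀ d → B.Dcol 1 d ≡ rightRow d - jump d
  Dcol-first-row d = trans (pairing-indicatorˡ 1≤i i<n (B.∂ d) μ-first-PL ∂-first-≢) (row-boundary d)

  Dcol-first-col : ∀ d → B.Dcol d 1 ≡ rightRow d - jump d
  Dcol-first-col d = trans (pairing-indicatorʳ 1≤i i<n (B.∂ d) μ-first-PL ∂-first-≢) (row-boundary d)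

  Dcol-inner : ∀ e e' → B.Dcol (suc (suc e)) (suc (suc e'))
               ≡ B'.Dcol (suc e) (suc e') + jump (suc (suc e')) * rightRow (suc (suc e))
                 + jump (suc (suc e)) * (rightRow (suc (suc e')) - jump (suc (suc e')))
  Dcol-inner e e' = begin
    pairing (B.∂ d) (B.∂ d')
      ≡⟨ pairing-updateˡ 1≤i i<n (B.∂ d') (∂-inner-≢ e) ⟩
    pairing (B'.∂ (suc e)) (B.∂ d') + (B.∂ d i - B'.∂ (suc e) i) * row i (B.∂ d')
      ≡⟨ cong₂ (λ p r → p + (B.∂ d i - B'.∂ (suc e) i) * r)
               (pairing-updateʳ 1≤i i<n (B'.∂ (suc e)) (∂-inner-≢ e')) (row-boundary d') ⟩
    pairing (B'.∂ (suc e)) (B'.∂ (suc e')) + (B.∂ d' i - B'.∂ (suc e') i) * row i (B'.∂ (suc e))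
      + (B.∂ d i - B'.∂ (suc e) i) * (rightRow d' - jump d')
      ≡⟨ cong₃ (λ x' r x → B'.Dcol (suc e) (suc e') + x' * r + x * (rightRow d' - jump d'))
               (sym (jump-inner e')) (sym (rightRow-inner e)) (sym (jump-inner e)) ⟩
    B'.Dcol (suc e) (suc e') + jump d' * rightRow d + jump d * (rightRow d' - jump d') ∎
    where
    open ≡-Reasoning
    d d' : ℕ
    d = suc (suc e)
    d' = suc (suc e')

  Bcol-first-row : ∀ d → B.Bcol 1 d ≡ - jump d
  Bcol-first-row d = begin
    B.Hcol 1 d + B.Dcol 1 d
      ≡⟨ cong₂ _+_ (Hcol-prepend 1 d) (Dcol-first-row d) ⟩
    (jump d * rightRow 1 - jump 1 * rightRow d) + ½ * shiftedFlux 1 d + (rightRow d - jump d)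
      ≡⟨ cong₃ (λ r₁ j₁ s → (jump d * r₁ - j₁ * rightRow d) + ½ * s + (rightRow d - jump d))
               rightRow-first jump-first (shiftedFlux-firstˡ d) ⟩
    (jump d * 0ℚ - 1ℚ * rightRow d) + ½ * 0ℚ + (rightRow d - jump d)
      ≡⟨ solve 2 (λ j r → (j :* con 0ℚ :- con 1ℚ :* r) :+ con ½ :* con 0ℚ :+ (r :- j) := :- j)
               refl (jump d) (rightRow d) ⟩
    - jump d ∎
    where open ≡-Reasoning

  Bcol-first-col : ∀ d → B.Bcol d 1 ≡ rightRow d + rightRow d - jump d
  Bcol-first-col d = begin
    B.Hcol d 1 + B.Dcol d 1
      ≡⟨ cong₂ _+_ (Hcol-prepend d 1) (Dcol-first-col d) ⟩
    (jump 1 * rightRow d - jump d * rightRow 1) + ½ * shiftedFlux d 1 + (rightRow d - jump d)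
      ≡⟨ cong₃ (λ r₁ j₁ s → (j₁ * rightRow d - jump d * r₁) + ½ * s + (rightRow d - jump d))
               rightRow-first jump-first (shiftedFlux-firstʳ d) ⟩
    (1ℚ * rightRow d - jump d * 0ℚ) + ½ * 0ℚ + (rightRow d - jump d)
      ≡⟨ solve 2 (λ j r → (con 1ℚ :* r :- j :* con 0ℚ) :+ con ½ :* con 0ℚ :+ (r :- j) := r :+ r :- j)
               refl (jump d) (rightRow d) ⟩
    rightRow d + rightRow d - jump d ∎
    where open ≡-Reasoning

  Bcol-inner : ∀ e e' → B.Bcol (suc (suc e)) (suc (suc e'))
               ≡ B'.Bcol (suc e) (suc e')
                 + (jump (suc (suc e')) * rightRow (suc (suc e)) + jump (suc (suc e')) * rightRow (suc (suc e)))
                 - jump (suc (suc e)) * jump (suc (suc e'))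
  Bcol-inner e e' = begin
    B.Hcol d d' + B.Dcol d d'
      ≡⟨ cong₂ _+_ (trans (Hcol-prepend d d') (cong ((jump d' * rightRow d - jump d * rightRow d') +_) (shiftedFlux-inner e e')))
                   (Dcol-inner e e') ⟩
    (jump d' * rightRow d - jump d * rightRow d') + B'.Hcol (suc e) (suc e')
      + (B'.Dcol (suc e) (suc e') + jump d' * rightRow d + jump d * (rightRow d' - jump d'))
      ≡⟨ solve 6 (λ j j' r r' h δ → (j' :* r :- j :* r') :+ h :+ (δ :+ j' :* r :+ j :* (r' :- j'))
                                   := h :+ δ :+ (j' :* r :+ j' :* r) :- j :* j')
               refl (jump d) (jump d') (rightRow d) (rightRow d') (B'.Hcol (suc e) (suc e')) (B'.Dcol (suc e) (suc e')) ⟩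
    B'.Bcol (suc e) (suc e') + (jump d' * rightRow d + jump d' * rightRow d) - jump d * jump d' ∎
    where
    open ≡-Reasoning
    d d' : ℕ
    d = suc (suc e)
    d' = suc (suc e')

  Bcol-first-first : B.Bcol 1 1 ≡ - 1ℚ
  Bcol-first-first = trans (Bcol-first-row 1) (cong -_ jump-first)

  Bcol-schur : ∀ {d d'} → 2 ≤ d → 2 ≤ d' → B.Bcol d d' + B.Bcol d 1 * B.Bcol 1 d' ≡ B'.Bcol (d ∸ 1) (d' ∸ 1)
  Bcol-schur {d@(suc (suc e))} {d'@(suc (suc e'))} (s≤s (s≤s _)) (s≤s (s≤s _)) = begin
    B.Bcol d d' + B.Bcol d 1 * B.Bcol 1 d'
      ≡⟨ cong₃ (λ x y z → x + y * z) (Bcol-inner e e') (Bcol-first-col d) (Bcol-first-row d') ⟩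
    (B'.Bcol (suc e) (suc e') + (jump d' * rightRow d + jump d' * rightRow d) - jump d * jump d')
      + (rightRow d + rightRow d - jump d) * - jump d'
      ≡⟨ solve 4 (λ b j j' r → (b :+ (j' :* r :+ j' :* r) :- j :* j') :+ (r :+ r :- j) :* (:- j') := b)
               refl (B'.Bcol (suc e) (suc e')) (jump d) (jump d') (rightRow d) ⟩
    B'.Bcol (suc e) (suc e') ∎
    where open ≡-Reasoning

-- Pivot elimination

∑-zero : ∀ {N} (f : Fin N → ℚ) → (∀ w → f w ≡ 0ℚ) → ∑ f ≡ 0ℚ
∑-zero {zero}  f f≡0 = refl
∑-zero {suc N} f f≡0 = cong₂ _+_ (f≡0 fzero) (∑-zero (f ∘ fsuc) (f≡0 ∘ fsuc))

∑-single : ∀ {N} (f : Fin N → ℚ) j → (∀ w → w ≢ j → f w ≡ 0ℚ) → ∑ f ≡ f j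
∑-single {suc N} f fzero    f≡0 =
  trans (cong (f fzero +_) (∑-zero (f ∘ fsuc) (λ w → f≡0 (fsuc w) (λ ())))) (ℚ.+-identityʳ (f fzero))
∑-single {suc N} f (fsuc j) f≡0 =
  trans (cong₂ _+_ (f≡0 fzero (λ ())) (∑-single (f ∘ fsuc) j (λ w w≢j → f≡0 (fsuc w) (w≢j ∘ Fin.suc-injective))))
        (ℚ.+-identityˡ (f (fsuc j)))

∑-pair : ∀ {N} (f : Fin N → ℚ) j k → j ≢ k → (∀ w → w ≢ j → w ≢ k → f w ≡ 0ℚ) → ∑ f ≡ f j + f k
∑-pair {suc N} f fzero    fzero    j≢k f≡0 = ⊥-elim (j≢k refl)
∑-pair {suc N} f fzero    (fsuc k) j≢k f≡0 =
  cong (f fzero +_) (∑-single (f ∘ fsuc) k (λ w w≢k → f≡0 (fsuc w) (λ ()) (w≢k ∘ Fin.suc-injective)))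
∑-pair {suc N} f (fsuc j) fzero    j≢k f≡0 =
  trans (cong (f fzero +_) (∑-single (f ∘ fsuc) j (λ w w≢j → f≡0 (fsuc w) (w≢j ∘ Fin.suc-injective) (λ ()))))
        (ℚ.+-comm (f fzero) (f (fsuc j)))
∑-pair {suc N} f (fsuc j) (fsuc k) j≢k f≡0 =
  trans (cong₂ _+_ (f≡0 fzero (λ ()) (λ ()))
                   (∑-pair (f ∘ fsuc) j k (j≢k ∘ cong fsuc)
                           (λ w w≢j w≢k → f≡0 (fsuc w) (w≢j ∘ Fin.suc-injective) (w≢k ∘ Fin.suc-injective))))
        (ℚ.+-identityˡ (f (fsuc j) + f (fsuc k)))

module Elimination {N : ℕ} (A : Mat N) (m : ℕ) where

  isPivot : Fin N → Bool
  isPivot y = toℕ y ≡ᵇ m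

  L R : Mat N
  L y x = if toℕ y ≡ᵇ toℕ x then 1ℚ else (if isPivot x then A y x else 0ℚ)
  R y x = if toℕ y ≡ᵇ toℕ x then 1ℚ else (if isPivot y then A y x else 0ℚ)

  pivotForm : Mat N → Mat N
  pivotForm C y x = if isPivot y ∧ isPivot x then - 1ℚ else (if isPivot y ∨ isPivot x then 0ℚ else C y x)

  module _ (p : Fin N) (p≡m : toℕ p ≡ m) where

    private
      isPivot-p : isPivot p ≡ true
      isPivot-p = trans (cong (_≡ᵇ m) p≡m) (≡ᵇ-refl m)

      isPivot-≢ : ∀ {y} → y ≢ p → isPivot y ≡ false
      isPivot-≢ y≢p = ≡ᵇ-≢ (λ y≡m → y≢p (Fin.toℕ-injective (trans y≡m (sym p≡m))))

      toℕ-≢ : ∀ {y x : Fin N} → y ≢ x → toℕ y ≢ toℕ x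
      toℕ-≢ y≢x = y≢x ∘ Fin.toℕ-injective

      L-diag : ∀ y → L y y ≡ 1ℚ
      L-diag y rewrite ≡ᵇ-refl (toℕ y) = refl

      L-pivot : ∀ {y} → y ≢ p → L y p ≡ A y p
      L-pivot y≢p rewrite ≡ᵇ-≢ (toℕ-≢ y≢p) | isPivot-p = refl

      L-off : ∀ {y w} → w ≢ y → w ≢ p → L y w ≡ 0ℚ
      L-off w≢y w≢p rewrite ≡ᵇ-≢ (toℕ-≢ (w≢y ∘ sym)) | isPivot-≢ w≢p = refl

      R-diag : ∀ x → R x x ≡ 1ℚ
      R-diag x rewrite ≡ᵇ-refl (toℕ x) = refl

      R-pivot : ∀ {x} → x ≢ p → R p x ≡ A p x
      R-pivot x≢p rewrite ≡ᵇ-≢ (toℕ-≢ (x≢p ∘ sym)) | isPivot-p = refl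

      R-off : ∀ {x w} → w ≢ x → w ≢ p → R w x ≡ 0ℚ
      R-off w≢x w≢p rewrite ≡ᵇ-≢ (toℕ-≢ w≢x) | isPivot-≢ w≢p = refl

    LA-pivot : ∀ z → (L ⊗ A) p z ≡ A p z
    LA-pivot z =
      trans (∑-single (λ w → L p w * A w z) p (λ w w≢p → trans (cong (_* A w z) (L-off w≢p w≢p)) (ℚ.*-zeroˡ (A w z))))
                       (trans (cong (_* A p z) (L-diag p)) (ℚ.*-identityˡ (A p z)))

    LA-other : ∀ {y} → y ≢ p → ∀ z → (L ⊗ A) y z ≡ A y z + A y p * A p z
    LA-other {y} y≢p z =
      trans (∑-pair (λ w → L y w * A w z) y p y≢p (λ w w≢y w≢p → trans (cong (_* A w z) (L-off w≢y w≢p)) (ℚ.*-zeroˡ (A w z))))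
            (cong₂ _+_ (trans (cong (_* A y z) (L-diag y)) (ℚ.*-identityˡ (A y z))) (cong (_* A p z) (L-pivot y≢p)))

    MR-pivot : ∀ (M : Mat N) y → (M ⊗ R) y p ≡ M y p
    MR-pivot M y =
      trans (∑-single (λ w → M y w * R w p) p (λ w w≢p → trans (cong (M y w *_) (R-off w≢p w≢p)) (ℚ.*-zeroʳ (M y w))))
                         (trans (cong (M y p *_) (R-diag p)) (ℚ.*-identityʳ (M y p)))

    MR-other : ∀ (M : Mat N) y {x} → x ≢ p → (M ⊗ R) y x ≡ M y x + M y p * A p x
    MR-other M y {x} x≢p =
      trans (∑-pair (λ w → M y w * R w x) x p x≢p (λ w w≢x w≢p → trans (cong (M y w *_) (R-off w≢x w≢p)) (ℚ.*-zeroʳ (M y w))))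
            (cong₂ _+_ (trans (cong (M y x *_) (R-diag x)) (ℚ.*-identityʳ (M y x))) (cong (M y p *_) (R-pivot x≢p)))

    LAR≡pivotForm : A p p ≡ - 1ℚ → ∀ (C : Mat N) → (∀ {y x} → y ≢ p → x ≢ p → A y x + A y p * A p x ≡ C y x) →
                    ∀ y x → ((L ⊗ A) ⊗ R) y x ≡ pivotForm C y x
    LAR≡pivotForm App≡-1 C C≡ y x with y Fin.≟ p | x Fin.≟ p
    ... | yes refl | yes refl rewrite isPivot-p = trans (MR-pivot (L ⊗ A) p) (trans (LA-pivot p) App≡-1)
    ... | yes refl | no x≢p rewrite isPivot-p | isPivot-≢ x≢p = begin
      ((L ⊗ A) ⊗ R) p x                    ≡⟨ MR-other (L ⊗ A) p x≢p ⟩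
      (L ⊗ A) p x + (L ⊗ A) p p * A p x    ≡⟨ cong₂ (λ a b → a + b * A p x) (LA-pivot x) (trans (LA-pivot p) App≡-1) ⟩
      A p x + - 1ℚ * A p x                 ≡⟨ solve 1 (λ a → a :+ con (- 1ℚ) :* a := con 0ℚ) refl (A p x) ⟩
      0ℚ                                   ∎
      where open ≡-Reasoning
    ... | no y≢p | yes refl rewrite isPivot-p | isPivot-≢ y≢p = begin
      ((L ⊗ A) ⊗ R) y p                    ≡⟨ MR-pivot (L ⊗ A) y ⟩
      (L ⊗ A) y p                          ≡⟨ LA-other y≢p p ⟩
      A y p + A y p * A p p                ≡⟨ cong (λ a → A y p + A y p * a) App≡-1 ⟩
      A y p + A y p * - 1ℚ                 ≡⟨ solve 1 (λ a → a :+ a :* con (- 1ℚ) := con 0ℚ) refl (A y p) ⟩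
      0ℚ                                   ∎
      where open ≡-Reasoning
    ... | no y≢p | no x≢p rewrite isPivot-≢ y≢p | isPivot-≢ x≢p = begin
      ((L ⊗ A) ⊗ R) y x
        ≡⟨ MR-other (L ⊗ A) y x≢p ⟩
      (L ⊗ A) y x + (L ⊗ A) y p * A p x
        ≡⟨ cong₂ (λ a b → a + b * A p x) (LA-other y≢p x) (LA-other y≢p p) ⟩
      (A y x + A y p * A p x) + (A y p + A y p * A p p) * A p x
        ≡⟨ cong (λ a → (A y x + A y p * A p x) + (A y p + A y p * a) * A p x) App≡-1 ⟩
      (A y x + A y p * A p x) + (A y p + A y p * - 1ℚ) * A p x
        ≡⟨ solve 3 (λ a b c → (a :+ b :* c) :+ (b :+ b :* con (- 1ℚ)) :* c := a :+ b :* c) refl (A y x) (A y p) (A p x) ⟩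
      A y x + A y p * A p x
        ≡⟨ C≡ y≢p x≢p ⟩
      C y x ∎
      where open ≡-Reasoning

middle-index : ∀ {L : List ℕ} xs z ys → L ≡ xs ++ z ∷ ys → Σ (Fin (length L)) λ p → toℕ p ≡ length xs × List.lookup L p ≡ z
middle-index []       z ys refl = fzero , refl , refl
middle-index (x ∷ xs) z ys refl with middle-index xs z ys refl
... | p , p≡ , lookup≡ = fsuc p , cong suc p≡ , lookup≡

lookup-outside-middle : ∀ {P : ℕ → Set} {L : List ℕ} xs z ys → L ≡ xs ++ z ∷ ys → All P xs → All P ys →
                        ∀ y → toℕ y ≢ length xs → P (List.lookup L y)
lookup-outside-middle []       z ys refl _          Pys fzero    y≢ = ⊥-elim (y≢ refl)
lookup-outside-middle []       z ys refl _          Pys (fsuc y) y≢ = All.lookup Pys (∈-lookup y)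
lookup-outside-middle (x ∷ xs) z ys refl (Px ∷ _)   Pys fzero    y≢ = Px
lookup-outside-middle (x ∷ xs) z ys refl (_ ∷ Pxs)  Pys (fsuc y) y≢ =
  lookup-outside-middle xs z ys refl Pxs Pys y (y≢ ∘ cong suc)

module Pivot (n i : ℕ) (β' : List ℕ) (J' : List Bool) (1≤i : 1 ≤ i) (i<n : i < n) where
  open Prepend n i β' J'
  open Entries n i β' J' 1≤i i<n

  inner mutableInner frozenInner : List ℕ
  inner = map suc (map suc innerBridges)
  mutableInner = List.filterᵇ B.isMutable inner
  frozenInner = List.filterᵇ (not ∘ B.isMutable) inner

  order-prepend : B.order ≡ mutableInner ++ 1 ∷ frozenInner
  order-prepend = cong (λ bs → List.filterᵇ B.isMutable bs ++ List.filterᵇ (not ∘ B.isMutable) bs) bridges-prepend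

  m-prepend : B.m ≡ length mutableInner
  m-prepend = cong (length ∘ List.filterᵇ B.isMutable) bridges-prepend

  inner-≥2 : All (2 ≤_) inner
  inner-≥2 = All.map⁺ (All.map⁺ (All.universal (λ _ → s≤s (s≤s z≤n)) innerBridges))

  private
    middle : Σ (Fin B.N) λ p → toℕ p ≡ length mutableInner × B.col p ≡ 1
    middle = middle-index mutableInner 1 frozenInner order-prepend

  pivot : Fin B.N
  pivot = proj₁ middle

  pivot-toℕ : toℕ pivot ≡ B.m
  pivot-toℕ = trans (proj₁ (proj₂ middle)) (sym m-prepend)

  col-pivot : B.col pivot ≡ 1
  col-pivot = proj₂ (proj₂ middle)

  col-other : ∀ {y} → y ≢ pivot → 2 ≤ B.col y
  col-other {y} y≢p = lookup-outside-middle mutableInner 1 frozenInner order-prepend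
    (All.filter⁺ (T? ∘ B.isMutable) inner-≥2) (All.filter⁺ (T? ∘ not ∘ B.isMutable) inner-≥2) y
    (λ y≡ → y≢p (Fin.toℕ-injective (trans y≡ (trans (sym m-prepend) (sym pivot-toℕ)))))

  open Elimination B.Bhat B.m

  LB̂R≡pivotForm : ∀ y x → ((L ⊗ B.Bhat) ⊗ R) y x ≡ pivotForm (λ y x → B'.Bcol (B.col y ∸ 1) (B.col x ∸ 1)) y x
  LB̂R≡pivotForm = LAR≡pivotForm pivot pivot-toℕ (trans (cong₂ B.Bcol col-pivot col-pivot) Bcol-first-first) _ complement
    where
    complement : ∀ {y x} → y ≢ pivot → x ≢ pivot →
                 B.Bhat y x + B.Bhat y pivot * B.Bhat pivot x ≡ B'.Bcol (B.col y ∸ 1) (B.col x ∸ 1)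
    complement {y} {x} y≢p x≢p =
      trans (cong (λ c → B.Bcol (B.col y) (B.col x) + B.Bcol (B.col y) c * B.Bcol c (B.col x)) col-pivot)
            (Bcol-schur (col-other y≢p) (col-other x≢p))

Jflags-prepend : ∀ u i β' → OneInJ u (i ∷ β') → Jflags u (i ∷ β') ≡ true ∷ Jflags u β'
Jflags-prepend u i β' = prepend (demSeq u β')
  where
  prepend : ∀ s → ix false (flags ((headD s ◁ i) ∷ s)) 0 ≡ true → flags ((headD s ◁ i) ∷ s) ≡ true ∷ flags s
  prepend []      ()
  prepend (a ∷ r) first = cong (_∷ flags (a ∷ r)) first

lemma3p9 : (n : ℕ) (u β : List ℕ) →
    IsPerm n u →
    All (λ i → 1 ≤ i × i < n) β →
    u₀ u β ≡ idPerm n →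
    OneInJ u β →
    (y x : Fin (Nv n u β)) →
      ((Lmat n u β ⊗ B̂ n u β) ⊗ Rmat n u β) y x ≡ Z₁ n u β y x
lemma3p9 n u []       _ _                   _ _      ()
lemma3p9 n u (i ∷ β') _ ((1≤i , i<n) ∷ _) _ oneInJ =
  subst statement (sym (Jflags-prepend u i β' oneInJ)) (Pivot.LB̂R≡pivotForm n i β' (Jflags u β') 1≤i i<n)
  where
  module C′ (J : List Bool) = Construction n (i ∷ β') J
  statement : List Bool → Set
  statement J = ∀ y x → ((Elimination.L (C′.Bhat J) (C′.m J) ⊗ C′.Bhat J) ⊗ Elimination.R (C′.Bhat J) (C′.m J)) y x
                        ≡ Elimination.pivotForm (C′.Bhat J) (C′.m J)
                            (λ y x → Construction.Bcol n β' (Jflags u β') (C′.col J y ∸ 1) (C′.col J x ∸ 1)) y x
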